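{- Let $M$ be a finite monoid. There exist a finite schema $\tau_M$ of unary relation symbols and a dynamic program $\Pi$ over alphabet $M$ maintaining relations over $\tau_M$ such that (i) all update formulas of $\Pi$ are $\Sigma_2$-formulas, and (ii) for every $x\in M$ there is a $\Sigma_2$-formula $\psi_x(j,k)$ over the input schema and $\tau_M$ that is satisfied (by the current input word $w$ and the auxiliary relations of $\Pi$) if and only if the infix $w_{j+1}\cdots w_{k-1}$ of $w$ evaluates to $x$ in $M$.
   Context: Dynamic descriptive complexity: a word $w_1\cdots w_n$ over alphabet $M$ (with $\epsilon$ identified with the identity of $M$) is encoded on domain $\{1,\dots,n\}$ with unary relations $W_m$ ($m\in M$, each position in at most one) and the order $\le$; changes $\mathrm{set}_m(i)$ set position $i$ to $m$. A dynamic program has, for each auxiliary relation $R$ and each change type $m$, an update formula $\varphi^R_m(\bar x;y)$; after $\mathrm{set}_m(i)$, new $R=\{\bar a:\varphi^R_m(\bar a;i)$ holds in (changed word, old auxiliary relations)$\}$. The initial word is $\epsilon^n$ (all identity) and initial auxiliary relations are first-order definable. A $\Sigma_2$-formula is a prenex formula $\exists^*\forall^*$ followed by a quantifier-free part. A word evaluates to $x$ if the product of its letters in $M$ is $x$ (the empty infix evaluates to the identity). -}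

module Defs where

open import Data.Nat using (ℕ; zero; suc)
open import Data.Fin using (Fin; zero; suc; _≤_; _<_; _<?_)
open import Data.List using (List; []; _∷_; filter; foldr)
open import Data.List.Base using (allFin)
open import Data.Product using (Σ; _×_; _,_)
open import Data.Sum using (_⊎_)
open import Data.Empty using (⊥)
open import Data.Unit using (⊤)
open import Relation.Nullary using (¬_)
open import Relation.Nullary.Decidable using (_×-dec_)
open import Relation.Binary.PropositionalEquality using (_≡_)

-- Finite monoids, presented with carrier Fin size (every finite monoid
-- is isomorphic to one of these).

record FinMonoid : Set where
  field
    size     : ℕ
    _∙_      : Fin size → Fin size → Fin size
    e        : Fin size
    assoc    : ∀ x y z → ((x ∙ y) ∙ z) ≡ (x ∙ (y ∙ z))
    identityˡ : ∀ x → (e ∙ x) ≡ x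
    identityʳ : ∀ x → (x ∙ e) ≡ x

-- First-order formulas over the schema
--   { W_c (c : Fin m) , ≤ } ∪ τ   with τ = k unary relation symbols,
-- with v free variables (de Bruijn style: a quantifier binds variable 0
-- and shifts the others by one).

data FO (m k : ℕ) : ℕ → Set where
  letter : ∀ {v} → Fin m → Fin v → FO m k v
  leq    : ∀ {v} → Fin v → Fin v → FO m k v
  eq     : ∀ {v} → Fin v → Fin v → FO m k v
  aux    : ∀ {v} → Fin k → Fin v → FO m k v
  tru    : ∀ {v} → FO m k v
  fls    : ∀ {v} → FO m k v
  neg    : ∀ {v} → FO m k v → FO m k v
  and    : ∀ {v} → FO m k v → FO m k v → FO m k v
  or     : ∀ {v} → FO m k v → FO m k v → FO m k v
  ex     : ∀ {v} → FO m k (suc v) → FO m k v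
  all    : ∀ {v} → FO m k (suc v) → FO m k v

data IsQF {m k : ℕ} : ∀ {v} → FO m k v → Set where
  letter : ∀ {v} c (x : Fin v) → IsQF (letter c x)
  leq    : ∀ {v} (x y : Fin v) → IsQF (leq {m} {k} x y)
  eq     : ∀ {v} (x y : Fin v) → IsQF (eq {m} {k} x y)
  aux    : ∀ {v} r (x : Fin v) → IsQF (aux r x)
  tru    : ∀ {v} → IsQF (tru {m} {k} {v})
  fls    : ∀ {v} → IsQF (fls {m} {k} {v})
  neg    : ∀ {v} {φ : FO m k v} → IsQF φ → IsQF (neg φ)
  and    : ∀ {v} {φ ψ : FO m k v} → IsQF φ → IsQF ψ → IsQF (and φ ψ)
  or     : ∀ {v} {φ ψ : FO m k v} → IsQF φ → IsQF ψ → IsQF (or φ ψ)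

data IsΠ1 {m k : ℕ} : ∀ {v} → FO m k v → Set where
  qf  : ∀ {v} {φ : FO m k v} → IsQF φ → IsΠ1 φ
  all : ∀ {v} {φ : FO m k (suc v)} → IsΠ1 φ → IsΠ1 (all φ)

data IsΣ2 {m k : ℕ} : ∀ {v} → FO m k v → Set where
  π1 : ∀ {v} {φ : FO m k v} → IsΠ1 φ → IsΣ2 φ
  ex : ∀ {v} {φ : FO m k (suc v)} → IsΣ2 φ → IsΣ2 (ex φ)

Word : ℕ → ℕ → Set
Word m n = Fin n → Fin m

AuxState : ℕ → ℕ → Set₁
AuxState k n = Fin k → Fin n → Set

extend : ∀ {n v} → Fin n → (Fin v → Fin n) → Fin (suc v) → Fin n
extend a ρ zero    = a
extend a ρ (suc i) = ρ i

Sat : ∀ {m k n v} → Word m n → AuxState k n → FO m k v → (Fin v → Fin n) → Set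
Sat w A (letter c x) ρ = w (ρ x) ≡ c
Sat w A (leq x y)    ρ = ρ x ≤ ρ y
Sat w A (eq x y)     ρ = ρ x ≡ ρ y
Sat w A (aux r x)    ρ = A r (ρ x)
Sat w A tru          ρ = ⊤
Sat w A fls          ρ = ⊥
Sat w A (neg φ)      ρ = ¬ Sat w A φ ρ
Sat w A (and φ ψ)    ρ = Sat w A φ ρ × Sat w A ψ ρ
Sat w A (or φ ψ)     ρ = Sat w A φ ρ ⊎ Sat w A ψ ρ
Sat w A (ex φ)       ρ = Σ (Fin _) λ a → Sat w A φ (extend a ρ)
Sat w A (all φ)      ρ = ∀ a → Sat w A φ (extend a ρ)

pair : ∀ {n} → Fin n → Fin n → Fin 2 → Fin n
pair a b zero       = a
pair a b (suc zero) = b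

single : ∀ {n} → Fin n → Fin 1 → Fin n
single a zero = a

noAux : ∀ {n} → AuxState 0 n
noAux ()

-- Dynamic programs over alphabet Fin m with k unary auxiliary relations.
-- update r c : formula φ^R_c(x ; y) with x = variable 0, y = variable 1.
-- init r     : first-order formula φ(x) over the input schema defining
--              the initial value of R on the initial word ε^n.

record DynProg (m k : ℕ) : Set where
  field
    update : Fin k → Fin m → FO m k 2
    init   : Fin k → FO m 0 1

module _ (M : FinMonoid) where
  open FinMonoid M

  Change : ℕ → Set
  Change n = Fin size × Fin n

  initWord : ∀ n → Word size n
  initWord n _ = e

  setWord : ∀ {n} → Word size n → Fin size → Fin n → Word size n
  setWord w c i j with Data.Fin._≟_ i j
  ... | Relation.Nullary.yes _ = c
  ... | Relation.Nullary.no  _ = w j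

  record State (k n : ℕ) : Set₁ where
    constructor st
    field
      word : Word size n
      auxs : AuxState k n

  initState : ∀ {k} (Π : DynProg size k) n → State k n
  initState Π n = st (initWord n)
    (λ r a → Sat (initWord n) noAux (DynProg.init Π r) (single a))

  step : ∀ {k n} (Π : DynProg size k) → State k n → Change n → State k n
  step Π (st w A) (c , i) =
    let w' = setWord w c i in
    st w' (λ r a → Sat w' A (DynProg.update Π r c) (pair a i))

  run : ∀ {k n} (Π : DynProg size k) → State k n → List (Change n) → State k n
  run Π s []       = s
  run Π s (ch ∷ cs) = run Π (step Π s ch) cs

  infixValue : ∀ {n} → Word size n → Fin n → Fin n → Fin size
  infixValue {n} w j k' =
    foldr (λ i acc → w i ∙ acc) e
      (filter (λ i → (j <? i) ×-dec (i <? k')) (allFin n))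

-- The program maintains, for every position z, a canonical numbering of the states of M.  A source
-- of s at z is a pair (b , q) with b ≤ z such that q, multiplied by the letters at b+1, …, z, gives s;
-- the age of s is its lexicographically least source, and its rank is the number of older states.
-- Ranks are elements of M, so they fit into unary relations: R_{s,r}(z) says that s has rank r at z,
-- and D_{r,r′}(z) that the letter at z moves the state of rank r at z − 1 to the state of rank r′.
--
-- Along a run, ranks never increase, so a run changes rank at most |M| times.  The value of the infix
-- (j, k) is therefore obtained by guessing the positions where the run from the identity at j drops
-- its rank, and checking with one universal quantifier that all positions in between step from the
-- current rank to itself: a Σ₂ property.  After position p is set to c, ranks before p are unchanged,
-- and the ranks at a ≥ p are a function of c, the old ranks at p − 1 and at a, and the old value of
-- the segment (p, a], itself obtained from an infix query.  Conjunctions, disjunctions and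
-- existential quantifications of Σ₂ formulas are again Σ₂ by the prenex laws.

module Submission where

open import Defs
open import Data.Bool using (Bool; true; false)
open import Data.Empty using (⊥)
open import Data.Unit using (tt)
open import Data.Nat as ℕ using (ℕ; zero; suc; _+_; _*_; _∸_; _≤_; _<_; z≤n; s≤s)
open import Data.Nat.Properties as ℕₚ
  using ( ≤-refl; ≤-reflexive; ≤-trans; ≤-antisym; ≤-pred; <-irrefl; <-trans; <-≤-trans; ≤-<-trans
        ; <⇒≤; <⇒≱; ≰⇒>; ≮⇒≥; n≤1+n; n<1+n; m≤n⇒m<n∨m≡n; m≤n⇒m≤1+n)
open import Data.Fin as Fin using (Fin; zero; suc; toℕ; fromℕ<; join; splitAt; combine; remQuot)
open import Data.Fin.Properties as Finₚ
  using ( any?; all?; toℕ<n; toℕ-injective; toℕ-fromℕ<; fromℕ<-toℕ; suc-injective; injective⇒≤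
        ; splitAt-join; remQuot-combine)
open import Data.List using (List; []; _∷_; foldr; filter; tabulate)
open import Data.Vec as Vec using (Vec; []; _∷_)
open import Data.Vec.Properties as Vecₚ using ()
open import Data.Product using (Σ; _×_; _,_; proj₁; proj₂; uncurry)
open import Data.Product.Function.NonDependent.Propositional using (_×-⇔_)
open import Data.Sum using (_⊎_; inj₁; inj₂; [_,_]′)
open import Data.Sum.Function.Propositional using (_⊎-⇔_)
open import Function.Base using (_∘_; id)
open import Function.Bundles using (_⇔_; mk⇔; Equivalence)
open import Function.Construct.Identity using (⇔-id)
open import Function.Construct.Symmetry using (⇔-sym)
open import Function.Properties.Equivalence using () renaming (trans to ⇔-trans)
open import Function.Related.TypeIsomorphisms using (¬-cong-⇔)
open import Relation.Nullary using (¬_; Dec; yes; no; does; contradiction)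
open import Relation.Nullary.Decidable as Dec using (dec-true; dec-false; _×-dec_; _⊎-dec_; _→-dec_; ¬?)
open import Relation.Unary using (Decidable)
open import Relation.Binary using (tri<; tri≈; tri>)
open import Relation.Binary.PropositionalEquality
  using (_≡_; _≢_; _≗_; refl; sym; trans; cong; cong₂; subst; subst₂; module ≡-Reasoning)

open Equivalence using (to; from)

private
  bit : Bool → ℕ
  bit true  = 1
  bit false = 0

  does-agree : ∀ {A B : Set} (a? : Dec A) (b? : Dec B) → A ⇔ B → does a? ≡ does b?
  does-agree (yes a) b? A⇔B = sym (dec-true b? (to A⇔B a))
  does-agree (no ¬a) b? A⇔B = sym (dec-false b? (¬a ∘ from A⇔B))

count : ∀ {S} {P : Fin S → Set} → Decidable P → ℕ
count {zero}  P? = 0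
count {suc S} P? = bit (does (P? zero)) + count (P? ∘ suc)

count-cong : ∀ {S} {P Q : Fin S → Set} (P? : Decidable P) (Q? : Decidable Q) →
             (∀ i → P i ⇔ Q i) → count P? ≡ count Q?
count-cong {zero}  P? Q? P⇔Q = refl
count-cong {suc S} P? Q? P⇔Q = cong₂ _+_ (cong bit (does-agree (P? zero) (Q? zero) (P⇔Q zero)))
                                         (count-cong (P? ∘ suc) (Q? ∘ suc) (P⇔Q ∘ suc))

count-mono : ∀ {S} {P Q : Fin S → Set} (P? : Decidable P) (Q? : Decidable Q) →
             (∀ {i} → P i → Q i) → count P? ≤ count Q?
count-mono {zero}  P? Q? P⊆Q = z≤n
count-mono {suc S} P? Q? P⊆Q with P? zero | Q? zero
... | yes _ | yes _ = s≤s (count-mono (P? ∘ suc) (Q? ∘ suc) P⊆Q)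
... | yes p | no ¬q = contradiction (P⊆Q p) ¬q
... | no _  | yes _ = m≤n⇒m≤1+n (count-mono (P? ∘ suc) (Q? ∘ suc) P⊆Q)
... | no _  | no _  = count-mono (P? ∘ suc) (Q? ∘ suc) P⊆Q

count-strict : ∀ {S} {P Q : Fin S → Set} (P? : Decidable P) (Q? : Decidable Q) →
               (∀ {i} → P i → Q i) → ∀ j → Q j → ¬ P j → count P? < count Q?
count-strict {suc S} P? Q? P⊆Q zero qj ¬pj with P? zero | Q? zero
... | yes pj | _     = contradiction pj ¬pj
... | no _   | yes _ = s≤s (count-mono (P? ∘ suc) (Q? ∘ suc) P⊆Q)
... | no _   | no ¬q = contradiction qj ¬q
count-strict {suc S} P? Q? P⊆Q (suc j) qj ¬pj with P? zero | Q? zero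
... | yes _ | yes _ = s≤s (count-strict (P? ∘ suc) (Q? ∘ suc) P⊆Q j qj ¬pj)
... | yes p | no ¬q = contradiction (P⊆Q p) ¬q
... | no _  | yes _ = m≤n⇒m≤1+n (count-strict (P? ∘ suc) (Q? ∘ suc) P⊆Q j qj ¬pj)
... | no _  | no _  = count-strict (P? ∘ suc) (Q? ∘ suc) P⊆Q j qj ¬pj

count-<-size : ∀ {S} {P : Fin S → Set} (P? : Decidable P) j → ¬ P j → count P? < S
count-<-size {S} P? j ¬pj = subst (count P? <_) (count-all S) (count-strict P? (λ _ → yes tt) (λ _ → tt) j tt ¬pj)
  where
  count-all : ∀ S → count {S} (λ _ → yes tt) ≡ S
  count-all zero    = refl
  count-all (suc S) = cong suc (count-all S)

count-none : ∀ {S} {P : Fin S → Set} (P? : Decidable P) → (∀ i → ¬ P i) → count P? ≡ 0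
count-none {zero}  P? ¬P = refl
count-none {suc S} P? ¬P with P? zero
... | yes p = contradiction p (¬P zero)
... | no _  = count-none (P? ∘ suc) (¬P ∘ suc)

count-below : ∀ {S} (j : Fin S) → count {S} (Fin._<? j) ≡ toℕ j
count-below {suc S} zero    = count-none {suc S} (Fin._<? zero {S}) λ _ ()
count-below {suc S} (suc j) = cong suc (trans (count-cong {S} (λ i → suc i Fin.<? suc j) (Fin._<? j) shift) (count-below j))
  where
  shift : ∀ i → suc i Fin.< suc j ⇔ i Fin.< j
  shift i = mk⇔ ≤-pred s≤s

private
  enum : ∀ {S} {P : Fin S → Set} (P? : Decidable P) → Fin (count P?) → Fin S
  enum {suc S} P? i with P? zero
  enum {suc S} P? zero    | yes _ = zero
  enum {suc S} P? (suc i) | yes _ = suc (enum (P? ∘ suc) i)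
  enum {suc S} P? i       | no _  = suc (enum (P? ∘ suc) i)

  enum-sound : ∀ {S} {P : Fin S → Set} (P? : Decidable P) i → P (enum P? i)
  enum-sound {suc S} P? i with P? zero
  enum-sound {suc S} P? zero    | yes p = p
  enum-sound {suc S} P? (suc i) | yes _ = enum-sound (P? ∘ suc) i
  enum-sound {suc S} P? i       | no _  = enum-sound (P? ∘ suc) i

  enum-injective : ∀ {S} {P : Fin S → Set} (P? : Decidable P) {i j} → enum P? i ≡ enum P? j → i ≡ j
  enum-injective {suc S} P? {i} {j} same with P? zero
  enum-injective {suc S} P? {zero}  {zero}  same | yes _ = refl
  enum-injective {suc S} P? {suc i} {suc j} same | yes _ = cong suc (enum-injective (P? ∘ suc) (suc-injective same))
  enum-injective {suc S} P? {i}     {j}     same | no _  = enum-injective (P? ∘ suc) (suc-injective same)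

  index : ∀ {S} {P : Fin S → Set} (P? : Decidable P) i → P i → Fin (count P?)
  index {suc S} P? i p with P? zero
  index {suc S} P? zero    p | yes _  = zero
  index {suc S} P? (suc i) p | yes _  = suc (index (P? ∘ suc) i p)
  index {suc S} P? zero    p | no ¬p0 = contradiction p ¬p0
  index {suc S} P? (suc i) p | no _   = index (P? ∘ suc) i p

  index-injective : ∀ {S} {P : Fin S → Set} (P? : Decidable P) {i j} (p : P i) (q : P j) →
                    index P? i p ≡ index P? j q → i ≡ j
  index-injective {suc S} P? {i} {j} p q same with P? zero
  index-injective {suc S} P? {zero}  {zero}  p q same | _      = refl
  index-injective {suc S} P? {suc i} {suc j} p q same | yes _  = cong suc (index-injective (P? ∘ suc) p q (suc-injective same))
  index-injective {suc S} P? {suc i} {suc j} p q same | no _   = cong suc (index-injective (P? ∘ suc) p q same)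
  index-injective {suc S} P? {zero}  {suc j} p q ()   | yes _
  index-injective {suc S} P? {suc i} {zero}  p q ()   | yes _
  index-injective {suc S} P? {zero}  {suc j} p q same | no ¬p0 = contradiction p ¬p0
  index-injective {suc S} P? {suc i} {zero}  p q same | no ¬p0 = contradiction q ¬p0

count-≤-injection : ∀ {S} {P Q : Fin S → Set} (P? : Decidable P) (Q? : Decidable Q) (f : Fin S → Fin S) →
                    (∀ {i} → P i → Q (f i)) → (∀ {i j} → P i → P j → f i ≡ f j → i ≡ j) →
                    count P? ≤ count Q?
count-≤-injection P? Q? f f-into f-injective = injective⇒≤ {f = g} g-injective
  where
  g : Fin (count P?) → Fin (count Q?)
  g i = index Q? (f (enum P? i)) (f-into (enum-sound P? i))
  g-injective : ∀ {i j} → g i ≡ g j → i ≡ j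
  g-injective {i} {j} same =
    enum-injective P? (f-injective (enum-sound P? i) (enum-sound P? j) (index-injective Q? _ _ same))

∃-cong : ∀ {A : Set} {P Q : A → Set} → (∀ a → P a ⇔ Q a) → Σ A P ⇔ Σ A Q
∃-cong P⇔Q = mk⇔ (λ (a , p) → a , to (P⇔Q a) p) (λ (a , q) → a , from (P⇔Q a) q)

∀-cong : ∀ {A : Set} {P Q : A → Set} → (∀ a → P a ⇔ Q a) → (∀ a → P a) ⇔ (∀ a → Q a)
∀-cong P⇔Q = mk⇔ (λ p a → to (P⇔Q a) (p a)) (λ q a → from (P⇔Q a) (q a))

module Prenex {m k : ℕ} where

  lift : ∀ {v u} → (Fin v → Fin u) → Fin (suc v) → Fin (suc u)
  lift f zero    = zero
  lift f (suc i) = suc (f i)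

  rename : ∀ {v u} → (Fin v → Fin u) → FO m k v → FO m k u
  rename f (letter c x) = letter c (f x)
  rename f (leq x y)    = leq (f x) (f y)
  rename f (eq x y)     = eq (f x) (f y)
  rename f (aux r x)    = aux r (f x)
  rename f tru          = tru
  rename f fls          = fls
  rename f (neg φ)      = neg (rename f φ)
  rename f (and φ ψ)    = and (rename f φ) (rename f ψ)
  rename f (or φ ψ)     = or (rename f φ) (rename f ψ)
  rename f (ex φ)       = ex (rename (lift f) φ)
  rename f (all φ)      = all (rename (lift f) φ)

  rename-QF : ∀ {v u} (f : Fin v → Fin u) {φ : FO m k v} → IsQF φ → IsQF (rename f φ)
  rename-QF f (letter c x) = letter c (f x)
  rename-QF f (leq x y)    = leq (f x) (f y)
  rename-QF f (eq x y)     = eq (f x) (f y)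
  rename-QF f (aux r x)    = aux r (f x)
  rename-QF f tru          = tru
  rename-QF f fls          = fls
  rename-QF f (neg p)      = neg (rename-QF f p)
  rename-QF f (and p q)    = and (rename-QF f p) (rename-QF f q)
  rename-QF f (or p q)     = or (rename-QF f p) (rename-QF f q)

  data Π₁ (v : ℕ) : Set where
    qf : (φ : FO m k v) → IsQF φ → Π₁ v
    ∀₁ : Π₁ (suc v) → Π₁ v

  data Σ₂ (v : ℕ) : Set where
    π₁ : Π₁ v → Σ₂ v
    ∃₂ : Σ₂ (suc v) → Σ₂ v

  ⌜_⌝Π : ∀ {v} → Π₁ v → FO m k v
  ⌜ qf φ _ ⌝Π = φ
  ⌜ ∀₁ φ ⌝Π   = all ⌜ φ ⌝Π

  ⌜_⌝ : ∀ {v} → Σ₂ v → FO m k v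
  ⌜ π₁ φ ⌝ = ⌜ φ ⌝Π
  ⌜ ∃₂ φ ⌝ = ex ⌜ φ ⌝

  ⌜⌝Π-isΠ1 : ∀ {v} (φ : Π₁ v) → IsΠ1 ⌜ φ ⌝Π
  ⌜⌝Π-isΠ1 (qf φ p) = qf p
  ⌜⌝Π-isΠ1 (∀₁ φ)   = all (⌜⌝Π-isΠ1 φ)

  ⌜⌝-isΣ2 : ∀ {v} (φ : Σ₂ v) → IsΣ2 ⌜ φ ⌝
  ⌜⌝-isΣ2 (π₁ φ) = π1 (⌜⌝Π-isΠ1 φ)
  ⌜⌝-isΣ2 (∃₂ φ) = ex (⌜⌝-isΣ2 φ)

  renameΠ : ∀ {v u} → (Fin v → Fin u) → Π₁ v → Π₁ u
  renameΠ f (qf φ p) = qf (rename f φ) (rename-QF f p)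
  renameΠ f (∀₁ φ)   = ∀₁ (renameΠ (lift f) φ)

  renameΣ : ∀ {v u} → (Fin v → Fin u) → Σ₂ v → Σ₂ u
  renameΣ f (π₁ φ) = π₁ (renameΠ f φ)
  renameΣ f (∃₂ φ) = ∃₂ (renameΣ (lift f) φ)

  -- Prenex laws: the leading quantifier of one side is pulled out over the other side,
  -- which is weakened by one variable.
  private
    andQF orQF : ∀ {v} (φ : FO m k v) → IsQF φ → Π₁ v → Π₁ v
    andQF φ p (qf ψ q) = qf (and φ ψ) (and p q)
    andQF φ p (∀₁ ψ)   = ∀₁ (andQF (rename suc φ) (rename-QF suc p) ψ)
    orQF φ p (qf ψ q)  = qf (or φ ψ) (or p q)
    orQF φ p (∀₁ ψ)    = ∀₁ (orQF (rename suc φ) (rename-QF suc p) ψ)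

  infixr 6 _∧Π_ _∧₂_
  infixr 5 _∨Π_ _∨₂_

  _∧Π_ _∨Π_ : ∀ {v} → Π₁ v → Π₁ v → Π₁ v
  qf φ p ∧Π ψ = andQF φ p ψ
  ∀₁ φ   ∧Π ψ = ∀₁ (φ ∧Π renameΠ suc ψ)
  qf φ p ∨Π ψ = orQF φ p ψ
  ∀₁ φ   ∨Π ψ = ∀₁ (φ ∨Π renameΠ suc ψ)

  private
    andΠ orΠ : ∀ {v} → Π₁ v → Σ₂ v → Σ₂ v
    andΠ φ (π₁ ψ) = π₁ (φ ∧Π ψ)
    andΠ φ (∃₂ ψ) = ∃₂ (andΠ (renameΠ suc φ) ψ)
    orΠ φ (π₁ ψ)  = π₁ (φ ∨Π ψ)
    orΠ φ (∃₂ ψ)  = ∃₂ (orΠ (renameΠ suc φ) ψ)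

  -- Opaque, so that ⟦ φ ∧₂ ψ ⟧ ρ does not unfold and the semantic lemmas below apply with φ and ψ inferred.
  opaque
    _∧₂_ _∨₂_ : ∀ {v} → Σ₂ v → Σ₂ v → Σ₂ v
    π₁ φ ∧₂ ψ = andΠ φ ψ
    ∃₂ φ ∧₂ ψ = ∃₂ (φ ∧₂ renameΣ suc ψ)
    π₁ φ ∨₂ ψ = orΠ φ ψ
    ∃₂ φ ∨₂ ψ = ∃₂ (φ ∨₂ renameΣ suc ψ)

  atom : ∀ {v} (φ : FO m k v) → IsQF φ → Σ₂ v
  atom φ p = π₁ (qf φ p)

  ∀qf : ∀ {v} (φ : FO m k (suc v)) → IsQF φ → Σ₂ v
  ∀qf φ p = π₁ (∀₁ (qf φ p))

  ⊤₂ ⊥₂ : ∀ {v} → Σ₂ v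
  ⊤₂ = atom tru tru
  ⊥₂ = atom fls fls

  ⋁ : ∀ {v} S → (Fin S → Σ₂ v) → Σ₂ v
  ⋁ zero    φ = ⊥₂
  ⋁ (suc S) φ = φ zero ∨₂ ⋁ S (φ ∘ suc)

  fromDec : ∀ {v} {P : Set} → Dec P → Σ₂ v
  fromDec (yes _) = ⊤₂
  fromDec (no _)  = ⊥₂

  -- Pulling ∀ out of ∧ and ∃ out of ∨ needs a non-empty domain (default);
  -- pulling ∀ out of ∨ needs decidable auxiliary relations (A?).
  module Semantics {n} (w : Word m n) (A : AuxState k n) (A? : ∀ r a → Dec (A r a)) (default : Fin n) where

    Env : ℕ → Set
    Env v = Fin v → Fin n

    ⟦_⟧Π : ∀ {v} → Π₁ v → Env v → Set
    ⟦ φ ⟧Π = Sat w A ⌜ φ ⌝Π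

    ⟦_⟧ : ∀ {v} → Σ₂ v → Env v → Set
    ⟦ φ ⟧ = Sat w A ⌜ φ ⌝

    sat? : ∀ {v} (φ : FO m k v) ρ → Dec (Sat w A φ ρ)
    sat? (letter c x) ρ = w (ρ x) Fin.≟ c
    sat? (leq x y)    ρ = ρ x Fin.≤? ρ y
    sat? (eq x y)     ρ = ρ x Fin.≟ ρ y
    sat? (aux r x)    ρ = A? r (ρ x)
    sat? tru          ρ = yes tt
    sat? fls          ρ = no λ ()
    sat? (neg φ)      ρ = ¬? (sat? φ ρ)
    sat? (and φ ψ)    ρ = sat? φ ρ ×-dec sat? ψ ρ
    sat? (or φ ψ)     ρ = sat? φ ρ ⊎-dec sat? ψ ρ
    sat? (ex φ)       ρ = any? λ a → sat? φ (extend a ρ)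
    sat? (all φ)      ρ = all? λ a → sat? φ (extend a ρ)

    private
      lift-agrees : ∀ {v u} {f : Fin v → Fin u} {ρ : Env u} {σ : Env v} a →
                    (∀ i → ρ (f i) ≡ σ i) → ∀ i → extend a ρ (lift f i) ≡ extend a σ i
      lift-agrees a agree zero    = refl
      lift-agrees a agree (suc i) = agree i

    rename-sat : ∀ {v u} (φ : FO m k v) (f : Fin v → Fin u) {ρ : Env u} {σ : Env v} →
                 (∀ i → ρ (f i) ≡ σ i) → Sat w A (rename f φ) ρ ⇔ Sat w A φ σ
    rename-sat (letter c x) f agree = mk⇔ (subst (λ a → w a ≡ c) (agree x)) (subst (λ a → w a ≡ c) (sym (agree x)))
    rename-sat (leq x y)    f agree = mk⇔ (subst₂ Fin._≤_ (agree x) (agree y))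
                                          (subst₂ Fin._≤_ (sym (agree x)) (sym (agree y)))
    rename-sat (eq x y)     f agree = mk⇔ (subst₂ _≡_ (agree x) (agree y)) (subst₂ _≡_ (sym (agree x)) (sym (agree y)))
    rename-sat (aux r x)    f agree = mk⇔ (subst (A r) (agree x)) (subst (A r) (sym (agree x)))
    rename-sat tru          f agree = ⇔-id _
    rename-sat fls          f agree = ⇔-id _
    rename-sat (neg φ)      f agree = ¬-cong-⇔ (rename-sat φ f agree)
    rename-sat (and φ ψ)    f agree = rename-sat φ f agree ×-⇔ rename-sat ψ f agree
    rename-sat (or φ ψ)     f agree = rename-sat φ f agree ⊎-⇔ rename-sat ψ f agree
    rename-sat (ex φ)       f agree = ∃-cong λ a → rename-sat φ (lift f) (lift-agrees a agree)
    rename-sat (all φ)      f agree = ∀-cong λ a → rename-sat φ (lift f) (lift-agrees a agree)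

    renameΠ-sat : ∀ {v u} (φ : Π₁ v) (f : Fin v → Fin u) {ρ : Env u} {σ : Env v} →
                  (∀ i → ρ (f i) ≡ σ i) → ⟦ renameΠ f φ ⟧Π ρ ⇔ ⟦ φ ⟧Π σ
    renameΠ-sat (qf φ _) f agree = rename-sat φ f agree
    renameΠ-sat (∀₁ φ)   f agree = ∀-cong λ a → renameΠ-sat φ (lift f) (lift-agrees a agree)

    renameΣ-sat : ∀ {v u} (φ : Σ₂ v) (f : Fin v → Fin u) {ρ : Env u} {σ : Env v} →
                  (∀ i → ρ (f i) ≡ σ i) → ⟦ renameΣ f φ ⟧ ρ ⇔ ⟦ φ ⟧ σ
    renameΣ-sat (π₁ φ) f agree = renameΠ-sat φ f agree
    renameΣ-sat (∃₂ φ) f agree = ∃-cong λ a → renameΣ-sat φ (lift f) (lift-agrees a agree)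

    private
      variable
        v : ℕ
        P : Set
        Q : Fin n → Set

      ∀-×ˡ : (∀ a → Q a × P) ⇔ ((∀ a → Q a) × P)
      ∀-×ˡ = mk⇔ (λ h → proj₁ ∘ h , proj₂ (h default)) (λ (q , p) a → q a , p)

      ∀-×ʳ : (∀ a → P × Q a) ⇔ (P × (∀ a → Q a))
      ∀-×ʳ = mk⇔ (λ h → proj₁ (h default) , proj₂ ∘ h) (λ (p , q) a → p , q a)

      ∀-⊎ˡ : Dec P → (∀ a → Q a ⊎ P) ⇔ ((∀ a → Q a) ⊎ P)
      ∀-⊎ˡ (yes p) = mk⇔ (λ _ → inj₂ p) (λ _ _ → inj₂ p)
      ∀-⊎ˡ (no ¬p) = mk⇔ (λ h → inj₁ λ a → [ id , (λ p → contradiction p ¬p) ]′ (h a))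
                         [ (λ q a → inj₁ (q a)) , (λ p _ → inj₂ p) ]′

      ∀-⊎ʳ : Dec P → (∀ a → P ⊎ Q a) ⇔ (P ⊎ (∀ a → Q a))
      ∀-⊎ʳ (yes p) = mk⇔ (λ _ → inj₁ p) (λ _ _ → inj₁ p)
      ∀-⊎ʳ (no ¬p) = mk⇔ (λ h → inj₂ λ a → [ (λ p → contradiction p ¬p) , id ]′ (h a))
                         [ (λ p _ → inj₁ p) , (λ q a → inj₂ (q a)) ]′

      ∃-×ˡ : Σ (Fin n) (λ a → Q a × P) ⇔ (Σ (Fin n) Q × P)
      ∃-×ˡ = mk⇔ (λ (a , q , p) → (a , q) , p) (λ ((a , q) , p) → a , q , p)

      ∃-×ʳ : Σ (Fin n) (λ a → P × Q a) ⇔ (P × Σ (Fin n) Q)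
      ∃-×ʳ = mk⇔ (λ (a , p , q) → p , a , q) (λ (p , a , q) → a , p , q)

      ∃-⊎ˡ : Σ (Fin n) (λ a → Q a ⊎ P) ⇔ (Σ (Fin n) Q ⊎ P)
      ∃-⊎ˡ = mk⇔ (λ { (a , inj₁ q) → inj₁ (a , q) ; (a , inj₂ p) → inj₂ p })
                 [ (λ (a , q) → a , inj₁ q) , (λ p → default , inj₂ p) ]′

      ∃-⊎ʳ : Σ (Fin n) (λ a → P ⊎ Q a) ⇔ (P ⊎ Σ (Fin n) Q)
      ∃-⊎ʳ = mk⇔ (λ { (a , inj₁ p) → inj₁ p ; (a , inj₂ q) → inj₂ (a , q) })
                 [ (λ p → default , inj₁ p) , (λ (a , q) → a , inj₂ q) ]′

      weaken-sat : ∀ (φ : Π₁ v) {ρ} a → ⟦ renameΠ suc φ ⟧Π (extend a ρ) ⇔ ⟦ φ ⟧Π ρ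
      weaken-sat φ a = renameΠ-sat φ suc λ _ → refl

      andQF-sat : ∀ (φ : FO m k v) p ψ {ρ} → ⟦ andQF φ p ψ ⟧Π ρ ⇔ (Sat w A φ ρ × ⟦ ψ ⟧Π ρ)
      andQF-sat φ p (qf ψ q) = ⇔-id _
      andQF-sat φ p (∀₁ ψ)   =
        ⇔-trans (∀-cong λ a → ⇔-trans (andQF-sat _ _ ψ) (rename-sat φ suc (λ _ → refl) ×-⇔ ⇔-id _)) ∀-×ʳ

      orQF-sat : ∀ (φ : FO m k v) p ψ {ρ} → ⟦ orQF φ p ψ ⟧Π ρ ⇔ (Sat w A φ ρ ⊎ ⟦ ψ ⟧Π ρ)
      orQF-sat φ p (qf ψ q)   = ⇔-id _
      orQF-sat φ p (∀₁ ψ) {ρ} =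
        ⇔-trans (∀-cong λ a → ⇔-trans (orQF-sat _ _ ψ) (rename-sat φ suc (λ _ → refl) ⊎-⇔ ⇔-id _)) (∀-⊎ʳ (sat? φ ρ))

    ∧Π-sat : ∀ (φ ψ : Π₁ v) {ρ} → ⟦ φ ∧Π ψ ⟧Π ρ ⇔ (⟦ φ ⟧Π ρ × ⟦ ψ ⟧Π ρ)
    ∧Π-sat (qf φ p) ψ = andQF-sat φ p ψ
    ∧Π-sat (∀₁ φ)   ψ = ⇔-trans (∀-cong λ a → ⇔-trans (∧Π-sat φ _) (⇔-id _ ×-⇔ weaken-sat ψ a)) ∀-×ˡ

    ∨Π-sat : ∀ (φ ψ : Π₁ v) {ρ} → ⟦ φ ∨Π ψ ⟧Π ρ ⇔ (⟦ φ ⟧Π ρ ⊎ ⟦ ψ ⟧Π ρ)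
    ∨Π-sat (qf φ p) ψ     = orQF-sat φ p ψ
    ∨Π-sat (∀₁ φ)   ψ {ρ} =
      ⇔-trans (∀-cong λ a → ⇔-trans (∨Π-sat φ _) (⇔-id _ ⊎-⇔ weaken-sat ψ a)) (∀-⊎ˡ (sat? ⌜ ψ ⌝Π ρ))

    private
      andΠ-sat : ∀ (φ : Π₁ v) ψ {ρ} → ⟦ andΠ φ ψ ⟧ ρ ⇔ (⟦ φ ⟧Π ρ × ⟦ ψ ⟧ ρ)
      andΠ-sat φ (π₁ ψ) = ∧Π-sat φ ψ
      andΠ-sat φ (∃₂ ψ) = ⇔-trans (∃-cong λ a → ⇔-trans (andΠ-sat _ ψ) (weaken-sat φ a ×-⇔ ⇔-id _)) ∃-×ʳ

      orΠ-sat : ∀ (φ : Π₁ v) ψ {ρ} → ⟦ orΠ φ ψ ⟧ ρ ⇔ (⟦ φ ⟧Π ρ ⊎ ⟦ ψ ⟧ ρ)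
      orΠ-sat φ (π₁ ψ) = ∨Π-sat φ ψ
      orΠ-sat φ (∃₂ ψ) = ⇔-trans (∃-cong λ a → ⇔-trans (orΠ-sat _ ψ) (weaken-sat φ a ⊎-⇔ ⇔-id _)) ∃-⊎ʳ

    opaque
      unfolding _∧₂_ _∨₂_

      ∧₂-sat : ∀ (φ ψ : Σ₂ v) {ρ} → ⟦ φ ∧₂ ψ ⟧ ρ ⇔ (⟦ φ ⟧ ρ × ⟦ ψ ⟧ ρ)
      ∧₂-sat (π₁ φ) ψ = andΠ-sat φ ψ
      ∧₂-sat (∃₂ φ) ψ =
        ⇔-trans (∃-cong λ a → ⇔-trans (∧₂-sat φ _) (⇔-id _ ×-⇔ renameΣ-sat ψ suc λ _ → refl)) ∃-×ˡ

      ∨₂-sat : ∀ (φ ψ : Σ₂ v) {ρ} → ⟦ φ ∨₂ ψ ⟧ ρ ⇔ (⟦ φ ⟧ ρ ⊎ ⟦ ψ ⟧ ρ)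
      ∨₂-sat (π₁ φ) ψ = orΠ-sat φ ψ
      ∨₂-sat (∃₂ φ) ψ =
        ⇔-trans (∃-cong λ a → ⇔-trans (∨₂-sat φ _) (⇔-id _ ⊎-⇔ renameΣ-sat ψ suc λ _ → refl)) ∃-⊎ˡ

    ⋁-sat : ∀ S (φ : Fin S → Σ₂ v) {ρ} → ⟦ ⋁ S φ ⟧ ρ ⇔ Σ (Fin S) λ i → ⟦ φ i ⟧ ρ
    ⋁-sat zero    φ = mk⇔ (λ ()) (λ ())
    ⋁-sat (suc S) φ = ⇔-trans (∨₂-sat (φ zero) _) (mk⇔
      [ (λ h → zero , h) , (λ h → let (i , hi) = to (⋁-sat S (φ ∘ suc)) h in suc i , hi) ]′
      λ { (zero , h) → inj₁ h ; (suc i , h) → inj₂ (from (⋁-sat S (φ ∘ suc)) (i , h)) })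

    fromDec-sat : ∀ (P? : Dec P) {ρ : Env v} → ⟦ fromDec P? ⟧ ρ ⇔ P
    fromDec-sat (yes p) = mk⇔ (λ _ → p) (λ _ → tt)
    fromDec-sat (no ¬p) = mk⇔ (λ ()) ¬p

module Segments (M : FinMonoid) where
  open FinMonoid M

  Elt : Set
  Elt = Fin size

  Seq : Set
  Seq = ℕ → Elt

  prod : Seq → ℕ → ℕ → Elt
  prod W a zero    = e
  prod W a (suc l) = W a ∙ prod W (suc a) l

  prod-++ : ∀ W a l₁ l₂ → prod W a (l₁ + l₂) ≡ prod W a l₁ ∙ prod W (a + l₁) l₂
  prod-++ W a zero     l₂ rewrite ℕₚ.+-identityʳ a = sym (identityˡ _)
  prod-++ W a (suc l₁) l₂ = begin
    W a ∙ prod W (suc a) (l₁ + l₂)                      ≡⟨ cong (W a ∙_) (prod-++ W (suc a) l₁ l₂) ⟩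
    W a ∙ (prod W (suc a) l₁ ∙ prod W (suc a + l₁) l₂)  ≡⟨ sym (assoc _ _ _) ⟩
    prod W a (suc l₁) ∙ prod W (suc a + l₁) l₂          ≡⟨ cong (λ t → prod W a (suc l₁) ∙ prod W t l₂) (ℕₚ.+-suc a l₁) ⟨
    prod W a (suc l₁) ∙ prod W (a + suc l₁) l₂          ∎
    where open ≡-Reasoning

  prod-cong : ∀ {W W′} a l → (∀ i → a ≤ i → i < a + l → W i ≡ W′ i) → prod W a l ≡ prod W′ a l
  prod-cong a zero    agree = refl
  prod-cong a (suc l) agree = cong₂ _∙_ (agree a ≤-refl (ℕₚ.m<m+n a (s≤s z≤n)))
    (prod-cong (suc a) l λ i a<i i<a+l → agree i (<⇒≤ a<i) (subst-< i<a+l))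
    where
    subst-< : ∀ {i} → i < suc a + l → i < a + suc l
    subst-< {i} lt rewrite ℕₚ.+-suc a l = lt

  prod-shift : ∀ W a l → prod (W ∘ suc) a l ≡ prod W (suc a) l
  prod-shift W a zero    = refl
  prod-shift W a (suc l) = cong (W (suc a) ∙_) (prod-shift W (suc a) l)

  -- segment W b z multiplies the letters at the positions in (b, z], between W j k those in (j, k)
  segment : Seq → ℕ → ℕ → Elt
  segment W b z = prod W (suc b) (z ∸ b)

  between : Seq → ℕ → ℕ → Elt
  between W j k = prod W (suc j) (k ∸ suc j)

  segment-≤ : ∀ W {b z} → z ≤ b → segment W b z ≡ e
  segment-≤ W z≤b rewrite ℕₚ.m≤n⇒m∸n≡0 z≤b = refl

  segment-split : ∀ W {b y z} → b ≤ y → y ≤ z → segment W b z ≡ segment W b y ∙ segment W y z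
  segment-split W {b} {y} {z} b≤y y≤z = begin
    prod W (suc b) (z ∸ b)                            ≡⟨ cong (prod W (suc b)) (sym ∸-split) ⟩
    prod W (suc b) ((y ∸ b) + (z ∸ y))                ≡⟨ prod-++ W (suc b) (y ∸ b) (z ∸ y) ⟩
    segment W b y ∙ prod W (suc b + (y ∸ b)) (z ∸ y)  ≡⟨ cong (λ t → segment W b y ∙ prod W (suc t) (z ∸ y)) b+[y∸b]≡y ⟩
    segment W b y ∙ segment W y z                     ∎
    where
    open ≡-Reasoning
    b+[y∸b]≡y = ℕₚ.m+[n∸m]≡n b≤y
    ∸-split : (y ∸ b) + (z ∸ y) ≡ z ∸ b
    ∸-split = trans (sym (ℕₚ.+-∸-comm (z ∸ y) b≤y)) (cong (_∸ b) (ℕₚ.m+[n∸m]≡n y≤z))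

  segment-snoc : ∀ W {b z} → b ≤ z → segment W b (suc z) ≡ segment W b z ∙ W (suc z)
  segment-snoc W {b} {z} b≤z = trans (segment-split W b≤z (n≤1+n z)) (cong (segment W b z ∙_) last)
    where
    last : segment W z (suc z) ≡ W (suc z)
    last rewrite ℕₚ.m+n∸n≡m 1 z = identityʳ _

  segment-between : ∀ W {j k} → j < k → segment W j k ≡ between W j k ∙ W k
  segment-between W {j} {suc k} (s≤s j≤k) = segment-snoc W j≤k

  between-empty : ∀ W {j k} → k ≤ suc j → between W j k ≡ e
  between-empty W k≤1+j rewrite ℕₚ.m≤n⇒m∸n≡0 k≤1+j = refl

  segment-cong : ∀ {W W′} b z → (∀ i → b < i → i ≤ z → W i ≡ W′ i) → segment W b z ≡ segment W′ b z
  segment-cong {W} {W′} b z agree with b ℕ.≤? z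
  ... | no b≰z  = trans (segment-≤ W z≤b) (sym (segment-≤ W′ z≤b))
    where z≤b = <⇒≤ (≰⇒> b≰z)
  ... | yes b≤z = prod-cong (suc b) (z ∸ b) λ i b<i i<end →
    agree i b<i (≤-pred (subst (i <_) (cong suc (ℕₚ.m+[n∸m]≡n b≤z)) i<end))

  segment-unit : ∀ b z → segment (λ _ → e) b z ≡ e
  segment-unit b z = prod-unit (suc b) (z ∸ b)
    where
    prod-unit : ∀ a l → prod (λ _ → e) a l ≡ e
    prod-unit a zero    = refl
    prod-unit a (suc l) = trans (cong (e ∙_) (prod-unit (suc a) l)) (identityˡ e)

Minimal : ∀ {A : Set} → (A → A → Set) → (A → Set) → A → Set
Minimal _<′_ P x = P x × (∀ {y} → y <′ x → ¬ P y)

least-ℕ : ∀ {P : ℕ → Set} → Decidable P → ∀ {z} → P z → Σ ℕ (Minimal _<_ P)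
least-ℕ {P} P? {z} pz = search 0 z (λ ()) (subst P (sym (ℕₚ.+-identityʳ z)) pz)
  where
  search : ∀ i f → (∀ {b} → b < i → ¬ P b) → P (f + i) → Σ ℕ (Minimal _<_ P)
  search i zero    below pf = i , pf , below
  search i (suc f) below pf with P? i
  ... | yes pi = i , pi , below
  ... | no ¬pi = search (suc i) f below′ (subst P (sym (ℕₚ.+-suc f i)) pf)
    where
    below′ : ∀ {b} → b < suc i → ¬ P b
    below′ b<1+i with m≤n⇒m<n∨m≡n (≤-pred b<1+i)
    ... | inj₁ b<i  = below b<i
    ... | inj₂ refl = ¬pi

least-Fin : ∀ {N} {P : Fin N → Set} → Decidable P → ∀ {q} → P q → Σ (Fin N) (Minimal Fin._<_ P)
least-Fin {suc N} P? {q} pq with P? zero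
... | yes p₀ = zero , p₀ , λ ()
least-Fin {suc N} P? {zero}  pq | no ¬p₀ = contradiction pq ¬p₀
least-Fin {suc N} P? {suc q} pq | no ¬p₀ with least-Fin (P? ∘ suc) pq
... | q₀ , pq₀ , below = suc q₀ , pq₀ , below′
  where
  below′ : ∀ {q′} → q′ Fin.< suc q₀ → ¬ _
  below′ {zero}   _           = ¬p₀
  below′ {suc q′} (s≤s q′<q₀) = below q′<q₀

module Ranks (M : FinMonoid) where
  open FinMonoid M
  open Segments M

  Source : Set
  Source = ℕ × Elt

  IsSource : Seq → ℕ → Elt → Source → Set
  IsSource W z s (b , q) = b ≤ z × q ∙ segment W b z ≡ s

  infix 4 _≺_ _⪯_

  _≺_ _⪯_ : Source → Source → Set
  (b₁ , q₁) ≺ (b₂ , q₂) = b₁ < b₂ ⊎ (b₁ ≡ b₂ × q₁ Fin.< q₂)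
  (b₁ , q₁) ⪯ (b₂ , q₂) = b₁ < b₂ ⊎ (b₁ ≡ b₂ × q₁ Fin.≤ q₂)

  ≺-⪯-trans : ∀ {c₁ c₂ c₃} → c₁ ≺ c₂ → c₂ ⪯ c₃ → c₁ ≺ c₃
  ≺-⪯-trans (inj₁ b₁<b₂)         (inj₁ b₂<b₃)         = inj₁ (<-trans b₁<b₂ b₂<b₃)
  ≺-⪯-trans (inj₁ b₁<b₂)         (inj₂ (refl , _))    = inj₁ b₁<b₂
  ≺-⪯-trans (inj₂ (refl , _))    (inj₁ b₂<b₃)         = inj₁ b₂<b₃
  ≺-⪯-trans (inj₂ (refl , q₁<q₂)) (inj₂ (refl , q₂≤q₃)) = inj₂ (refl , <-≤-trans q₁<q₂ q₂≤q₃)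

  ⪯-≺-trans : ∀ {c₁ c₂ c₃} → c₁ ⪯ c₂ → c₂ ≺ c₃ → c₁ ≺ c₃
  ⪯-≺-trans (inj₁ b₁<b₂)         (inj₁ b₂<b₃)         = inj₁ (<-trans b₁<b₂ b₂<b₃)
  ⪯-≺-trans (inj₁ b₁<b₂)         (inj₂ (refl , _))    = inj₁ b₁<b₂
  ⪯-≺-trans (inj₂ (refl , _))    (inj₁ b₂<b₃)         = inj₁ b₂<b₃
  ⪯-≺-trans (inj₂ (refl , q₁≤q₂)) (inj₂ (refl , q₂<q₃)) = inj₂ (refl , ≤-<-trans q₁≤q₂ q₂<q₃)

  ≺⇒⪯ : ∀ {c₁ c₂} → c₁ ≺ c₂ → c₁ ⪯ c₂
  ≺⇒⪯ (inj₁ b₁<b₂)          = inj₁ b₁<b₂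
  ≺⇒⪯ (inj₂ (b₁≡b₂ , q₁<q₂)) = inj₂ (b₁≡b₂ , <⇒≤ q₁<q₂)

  ≺-irrefl : ∀ {c} → ¬ c ≺ c
  ≺-irrefl (inj₁ b<b)       = <-irrefl refl b<b
  ≺-irrefl (inj₂ (_ , q<q)) = <-irrefl refl q<q

  ⪯⇒≤ : ∀ {c₁ c₂} → c₁ ⪯ c₂ → proj₁ c₁ ≤ proj₁ c₂
  ⪯⇒≤ (inj₁ b₁<b₂)      = <⇒≤ b₁<b₂
  ⪯⇒≤ (inj₂ (refl , _)) = ≤-refl

  _≺?_ : ∀ c₁ c₂ → Dec (c₁ ≺ c₂)
  (b₁ , q₁) ≺? (b₂ , q₂) = (b₁ ℕ.<? b₂) ⊎-dec ((b₁ ℕ.≟ b₂) ×-dec (q₁ Fin.<? q₂))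

  ≺-trichotomy : ∀ c₁ c₂ → c₁ ≺ c₂ ⊎ c₁ ≡ c₂ ⊎ c₂ ≺ c₁
  ≺-trichotomy (b₁ , q₁) (b₂ , q₂) with ℕₚ.<-cmp b₁ b₂
  ... | tri< b₁<b₂ _ _ = inj₁ (inj₁ b₁<b₂)
  ... | tri> _ _ b₂<b₁ = inj₂ (inj₂ (inj₁ b₂<b₁))
  ... | tri≈ _ refl _ with Finₚ.<-cmp q₁ q₂
  ...   | tri< q₁<q₂ _ _ = inj₁ (inj₂ (refl , q₁<q₂))
  ...   | tri≈ _ refl _  = inj₂ (inj₁ refl)
  ...   | tri> _ _ q₂<q₁ = inj₂ (inj₂ (inj₂ (refl , q₂<q₁)))

  self-source : ∀ W z s → IsSource W z s (z , s)
  self-source W z s = ≤-refl , trans (cong (s ∙_) (segment-≤ W {z} ≤-refl)) (identityʳ s)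

  opaque
    private
      Reaches : Seq → ℕ → Elt → ℕ → Elt → Set
      Reaches W z s b q = q ∙ segment W b z ≡ s

      earliest : ∀ W z s → Σ ℕ (Minimal _<_ λ b → Σ Elt (Reaches W z s b))
      earliest W z s = least-ℕ (λ b → any? λ q → q ∙ segment W b z Fin.≟ s) {z} (s , proj₂ (self-source W z s))

      least-state : ∀ W z s → Σ Elt (Minimal Fin._<_ (Reaches W z s (proj₁ (earliest W z s))))
      least-state W z s =
        least-Fin (λ q → q ∙ segment W (proj₁ (earliest W z s)) z Fin.≟ s) (proj₂ (proj₁ (proj₂ (earliest W z s))))

    age : Seq → ℕ → Elt → Source
    age W z s = proj₁ (earliest W z s) , proj₁ (least-state W z s)

    age-source : ∀ W z s → IsSource W z s (age W z s)
    age-source W z s = ≮⇒≥ (λ z<b₀ → proj₂ (proj₂ (earliest W z s)) z<b₀ (s , proj₂ (self-source W z s))) ,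
                       proj₁ (proj₂ (least-state W z s))

    age-least : ∀ W z s c → IsSource W z s c → age W z s ⪯ c
    age-least W z s (b , q) (_ , reach)
      with m≤n⇒m<n∨m≡n (≮⇒≥ λ b<b₀ → proj₂ (proj₂ (earliest W z s)) b<b₀ (q , reach))
    ... | inj₁ b₀<b  = inj₁ b₀<b
    ... | inj₂ refl = inj₂ (refl , ≮⇒≥ λ q<q₀ → proj₂ (proj₂ (least-state W z s)) q<q₀ reach)

  older : Seq → ℕ → Elt → Elt → Set
  older W z s₁ s₂ = age W z s₁ ≺ age W z s₂

  older? : ∀ W z s₁ s₂ → Dec (older W z s₁ s₂)
  older? W z s₁ s₂ = age W z s₁ ≺? age W z s₂

  older-irrefl : ∀ {W z s} → ¬ older W z s s
  older-irrefl = ≺-irrefl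

  older-trans : ∀ {W z s₁ s₂ s₃} → older W z s₁ s₂ → older W z s₂ s₃ → older W z s₁ s₃
  older-trans o₁₂ o₂₃ = ≺-⪯-trans o₁₂ (≺⇒⪯ o₂₃)

  Precedes : Seq → ℕ → Elt → Elt → Set
  Precedes W z s₁ s₂ = Σ Source λ c₁ → IsSource W z s₁ c₁ × (∀ c₂ → IsSource W z s₂ c₂ → c₁ ≺ c₂)

  older⇔precedes : ∀ W z s₁ s₂ → older W z s₁ s₂ ⇔ Precedes W z s₁ s₂
  older⇔precedes W z s₁ s₂ = mk⇔
    (λ o → age W z s₁ , age-source W z s₁ , λ c₂ src → ≺-⪯-trans o (age-least W z s₂ c₂ src))
    (λ (c₁ , src , first) → ⪯-≺-trans (age-least W z s₁ c₁ src) (first _ (age-source W z s₂)))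

  age-injective : ∀ W z {s₁ s₂} → age W z s₁ ≡ age W z s₂ → s₁ ≡ s₂
  age-injective W z {s₁} {s₂} same = begin
    s₁                                                       ≡⟨ sym (proj₂ (age-source W z s₁)) ⟩
    proj₂ (age W z s₁) ∙ segment W (proj₁ (age W z s₁)) z    ≡⟨ cong (λ c → proj₂ c ∙ segment W (proj₁ c) z) same ⟩
    proj₂ (age W z s₂) ∙ segment W (proj₁ (age W z s₂)) z    ≡⟨ proj₂ (age-source W z s₂) ⟩
    s₂                                                       ∎
    where open ≡-Reasoning

  older-trichotomy : ∀ W z s₁ s₂ → older W z s₁ s₂ ⊎ s₁ ≡ s₂ ⊎ older W z s₂ s₁
  older-trichotomy W z s₁ s₂ with ≺-trichotomy (age W z s₁) (age W z s₂)
  ... | inj₁ o         = inj₁ o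
  ... | inj₂ (inj₁ same) = inj₂ (inj₁ (age-injective W z same))
  ... | inj₂ (inj₂ o)  = inj₂ (inj₂ o)

  opaque
    rank : Seq → ℕ → Elt → Elt
    rank W z s = fromℕ< (count-<-size (λ s′ → older? W z s′ s) s older-irrefl)

    toℕ-rank : ∀ W z s → toℕ (rank W z s) ≡ count (λ s′ → older? W z s′ s)
    toℕ-rank W z s = toℕ-fromℕ< _

  older⇒rank< : ∀ {W z s₁ s₂} → older W z s₁ s₂ → rank W z s₁ Fin.< rank W z s₂
  older⇒rank< {W} {z} {s₁} {s₂} o rewrite toℕ-rank W z s₁ | toℕ-rank W z s₂ =
    count-strict (λ s′ → older? W z s′ s₁) (λ s′ → older? W z s′ s₂) (λ o′ → older-trans o′ o) s₁ o older-irrefl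

  rank-injective : ∀ {W z s₁ s₂} → rank W z s₁ ≡ rank W z s₂ → s₁ ≡ s₂
  rank-injective {W} {z} {s₁} {s₂} same with older-trichotomy W z s₁ s₂
  ... | inj₁ o          = contradiction (older⇒rank< o) (<-irrefl (cong toℕ same))
  ... | inj₂ (inj₁ s≡s) = s≡s
  ... | inj₂ (inj₂ o)   = contradiction (older⇒rank< o) (<-irrefl (cong toℕ (sym same)))

  rank<⇒older : ∀ {W z s₁ s₂} → rank W z s₁ Fin.< rank W z s₂ → older W z s₁ s₂
  rank<⇒older {W} {z} {s₁} {s₂} lt with older-trichotomy W z s₁ s₂
  ... | inj₁ o         = o
  ... | inj₂ (inj₁ refl) = contradiction lt (<-irrefl refl)
  ... | inj₂ (inj₂ o)  = contradiction (older⇒rank< o) (ℕₚ.<-asym lt)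

  source-snoc : ∀ W z {s c} → IsSource W z s c → IsSource W (suc z) (s ∙ W (suc z)) c
  source-snoc W z {s} {b , q} (b≤z , reach) = ≤-trans b≤z (n≤1+n z) , (begin
    q ∙ segment W b (suc z)           ≡⟨ cong (q ∙_) (segment-snoc W b≤z) ⟩
    q ∙ (segment W b z ∙ W (suc z))   ≡⟨ sym (assoc _ _ _) ⟩
    (q ∙ segment W b z) ∙ W (suc z)   ≡⟨ cong (_∙ W (suc z)) reach ⟩
    s ∙ W (suc z)                     ∎)
    where open ≡-Reasoning

  -- Every state older than s·W(z+1) at z+1 arises from a state older than s at z;
  -- hence ranks never increase along a run.
  rank-antitone : ∀ W z s → rank W (suc z) (s ∙ W (suc z)) Fin.≤ rank W z s
  rank-antitone W z s rewrite toℕ-rank W (suc z) (s ∙ W (suc z)) | toℕ-rank W z s =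
    count-≤-injection (λ t → older? W (suc z) t (s ∙ W (suc z))) (λ t → older? W z t s) back
      (λ o → proj₂ (back-spec o))
      (λ {t₁} {t₂} o₁ o₂ same → begin
        t₁                   ≡⟨ sym (proj₁ (back-spec o₁)) ⟩
        back t₁ ∙ W (suc z)  ≡⟨ cong (_∙ W (suc z)) same ⟩
        back t₂ ∙ W (suc z)  ≡⟨ proj₁ (back-spec o₂) ⟩
        t₂                   ∎)
    where
    open ≡-Reasoning
    back : Elt → Elt
    back t = proj₂ (age W (suc z) t) ∙ segment W (proj₁ (age W (suc z) t)) z

    back-spec : ∀ {t} → older W (suc z) t (s ∙ W (suc z)) → back t ∙ W (suc z) ≡ t × older W z (back t) s
    back-spec {t} o = stepped , ⪯-≺-trans (age-least W z (back t) _ (b≤z , refl)) t≺s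
      where
      t≺s : age W (suc z) t ≺ age W z s
      t≺s = ≺-⪯-trans o (age-least W (suc z) _ _ (source-snoc W z (age-source W z s)))
      b≤z : proj₁ (age W (suc z) t) ≤ z
      b≤z = ≤-trans (⪯⇒≤ (≺⇒⪯ t≺s)) (proj₁ (age-source W z s))
      stepped : back t ∙ W (suc z) ≡ t
      stepped = trans (assoc _ _ _) (trans (cong (proj₂ (age W (suc z) t) ∙_) (sym (segment-snoc W b≤z)))
                                           (proj₂ (age-source W (suc z) t)))

  older-cong : ∀ {W W′ z s₁ s₂} → (∀ c → IsSource W z s₁ c ⇔ IsSource W′ z s₁ c) →
               (∀ c → IsSource W z s₂ c ⇔ IsSource W′ z s₂ c) → older W z s₁ s₂ → older W′ z s₁ s₂
  older-cong {W} {W′} {z} {s₁} {s₂} src₁ src₂ o with to (older⇔precedes W z s₁ s₂) o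
  ... | c₁ , source , first = from (older⇔precedes W′ z s₁ s₂)
    (c₁ , to (src₁ c₁) source , λ c₂ source₂ → first c₂ (from (src₂ c₂) source₂))

  rank-count : ∀ W z s {P : Elt → Set} (P? : Decidable P) → (∀ s′ → older W z s′ s ⇔ P s′) →
               toℕ (rank W z s) ≡ count P?
  rank-count W z s P? older⇔P = trans (toℕ-rank W z s) (count-cong (λ s′ → older? W z s′ s) P? older⇔P)

  rank-agree : ∀ {W W′} z → (∀ i → 0 < i → i ≤ z → W i ≡ W′ i) → ∀ s → rank W z s ≡ rank W′ z s
  rank-agree {W} {W′} z agree s =
    toℕ-injective (trans (rank-count W z s (λ s′ → older? W′ z s′ s) same-order) (sym (toℕ-rank W′ z s)))
    where
    same-segment : ∀ b → segment W b z ≡ segment W′ b z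
    same-segment b = segment-cong b z λ i b<i i≤z → agree i (≤-<-trans z≤n b<i) i≤z
    sources : ∀ {s} c → IsSource W z s c ⇔ IsSource W′ z s c
    sources (b , q) = mk⇔ (λ (b≤z , reach) → b≤z , trans (cong (q ∙_) (sym (same-segment b))) reach)
                          (λ (b≤z , reach) → b≤z , trans (cong (q ∙_) (same-segment b)) reach)
    same-order : ∀ s′ → older W z s′ s ⇔ older W′ z s′ s
    same-order s′ = mk⇔ (older-cong sources sources) (older-cong (⇔-sym ∘ sources) (⇔-sym ∘ sources))

  -- In the word of identities the least source of s is (0 , s).
  rank-unit : ∀ z s → rank (λ _ → e) z s ≡ s
  rank-unit z s = toℕ-injective (trans (rank-count _ z s (Fin._<? s) older⇔<) (count-below s))
    where
    unit-source : ∀ {s b q} → IsSource (λ _ → e) z s (b , q) → q ≡ s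
    unit-source {s} {b} {q} (_ , reach) = trans (sym (identityʳ q)) (trans (cong (q ∙_) (sym (segment-unit b z))) reach)
    source-at-0 : ∀ s → IsSource (λ _ → e) z s (0 , s)
    source-at-0 s = z≤n , trans (cong (s ∙_) (segment-unit 0 z)) (identityʳ s)
    older⇔< : ∀ s′ → older (λ _ → e) z s′ s ⇔ s′ Fin.< s
    older⇔< s′ = ⇔-trans (older⇔precedes _ z s′ s) (mk⇔ to< from<)
      where
      to< : Precedes (λ _ → e) z s′ s → s′ Fin.< s
      to< ((b , q) , source , first) with unit-source source | first (0 , s) (source-at-0 s)
      ... | refl | inj₂ (_ , q<s) = q<s
      from< : s′ Fin.< s → Precedes (λ _ → e) z s′ s
      from< s′<s = (0 , s′) , source-at-0 s′ , λ where
        (zero , q) source  → inj₂ (refl , subst (s′ Fin.<_) (sym (unit-source source)) s′<s)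
        (suc b , q) _      → inj₁ (s≤s z≤n)

  opaque
    setSeq : Seq → ℕ → Elt → Seq
    setSeq W p c i with i ℕ.≟ p
    ... | yes _ = c
    ... | no _  = W i

    setSeq-same : ∀ W p c → setSeq W p c p ≡ c
    setSeq-same W p c with p ℕ.≟ p
    ... | yes _  = refl
    ... | no p≢p = contradiction refl p≢p

    setSeq-other : ∀ W {p} c {i} → i ≢ p → setSeq W p c i ≡ W i
    setSeq-other W {p} c {i} i≢p with i ℕ.≟ p
    ... | yes i≡p = contradiction i≡p i≢p
    ... | no _    = refl

  -- Position 0 never lies in a segment, and a change after z does not affect z.
  rank-unaffected : ∀ W p c z → p ≡ 0 ⊎ z < p → ∀ s → rank (setSeq W p c) z s ≡ rank W z s
  rank-unaffected W p c z p≡0⊎z<p = rank-agree z λ i 0<i i≤z → setSeq-other W c (i≢p 0<i i≤z p≡0⊎z<p)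
    where
    i≢p : ∀ {i} → 0 < i → i ≤ z → p ≡ 0 ⊎ z < p → i ≢ p
    i≢p 0<i i≤z (inj₁ refl) refl = <-irrefl refl 0<i
    i≢p 0<i i≤z (inj₂ z<p)  refl = <-irrefl refl (≤-<-trans i≤z z<p)

module AfterSet (M : FinMonoid) where
  open FinMonoid M
  open Segments M
  open Ranks M

  infix 4 _∈M∙_ _∈M∙?_

  _∈M∙_ : Elt → Elt → Set
  s ∈M∙ m = Σ Elt λ q → q ∙ m ≡ s

  _∈M∙?_ : ∀ s m → Dec (s ∈M∙ m)
  s ∈M∙? m = any? λ q → q ∙ m Fin.≟ s

  ReachedFirst : (Elt → Elt) → Elt → Elt → Elt → Set
  ReachedFirst ρ m s₁ s₂ = Σ Elt λ q₁ → q₁ ∙ m ≡ s₁ × (∀ q₂ → q₂ ∙ m ≡ s₂ → ρ q₁ Fin.< ρ q₂)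

  reachedFirst? : ∀ ρ m s₁ s₂ → Dec (ReachedFirst ρ m s₁ s₂)
  reachedFirst? ρ m s₁ s₂ =
    any? λ q₁ → (q₁ ∙ m Fin.≟ s₁) ×-dec all? λ q₂ → (q₂ ∙ m Fin.≟ s₂) →-dec (ρ q₁ Fin.<? ρ q₂)

  -- The age order after setting position y+1 to c, in terms of ρ₁ (ranks at y), m (the old
  -- segment (y+1, a]) and ρ₂ (old ranks at a): sources before y+1 come first, ordered by ρ₁;
  -- then sources at y+1, ordered by their state; then the unaffected sources after y+1.
  OlderAfterSet : (ρ₁ ρ₂ : Elt → Elt) (m c s₁ s₂ : Elt) → Set
  OlderAfterSet ρ₁ ρ₂ m c s₁ s₂ =
    ReachedFirst ρ₁ (c ∙ m) s₁ s₂ ⊎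
    (¬ s₁ ∈M∙ c ∙ m × ¬ s₂ ∈M∙ c ∙ m ×
      (ReachedFirst id m s₁ s₂ ⊎ (¬ s₁ ∈M∙ m × ¬ s₂ ∈M∙ m × ρ₂ s₁ Fin.< ρ₂ s₂)))

  olderAfterSet? : ∀ ρ₁ ρ₂ m c s₁ s₂ → Dec (OlderAfterSet ρ₁ ρ₂ m c s₁ s₂)
  olderAfterSet? ρ₁ ρ₂ m c s₁ s₂ =
    reachedFirst? ρ₁ (c ∙ m) s₁ s₂ ⊎-dec
    (¬? (s₁ ∈M∙? c ∙ m) ×-dec ¬? (s₂ ∈M∙? c ∙ m) ×-dec
      (reachedFirst? id m s₁ s₂ ⊎-dec (¬? (s₁ ∈M∙? m) ×-dec ¬? (s₂ ∈M∙? m) ×-dec (ρ₂ s₁ Fin.<? ρ₂ s₂))))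

  rankAfterSet : (ρ₁ ρ₂ : Elt → Elt) (m c s : Elt) → ℕ
  rankAfterSet ρ₁ ρ₂ m c s = count λ s′ → olderAfterSet? ρ₁ ρ₂ m c s′ s

  module AfterSetAt (W : Seq) (y : ℕ) (c : Elt) (a : ℕ) (y<a : y < a) where

    W′ : Seq
    W′ = setSeq W (suc y) c

    m : Elt
    m = segment W (suc y) a

    private
      y≤a : y ≤ a
      y≤a = <⇒≤ y<a

      segment-above : ∀ {b} → suc y ≤ b → segment W′ b a ≡ segment W b a
      segment-above {b} y<b = segment-cong b a λ i b<i _ →
        setSeq-other W c λ i≡1+y → <-irrefl (sym i≡1+y) (≤-<-trans y<b b<i)

      segment-below : ∀ {b} → b ≤ y → segment W′ b a ≡ segment W b y ∙ (c ∙ m)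
      segment-below {b} b≤y = begin
        segment W′ b a                   ≡⟨ segment-split W′ b≤y y≤a ⟩
        segment W′ b y ∙ segment W′ y a  ≡⟨ cong₂ _∙_ before from-y ⟩
        segment W b y ∙ (c ∙ m)          ∎
        where
        open ≡-Reasoning
        before : segment W′ b y ≡ segment W b y
        before = segment-cong b y λ i _ i≤y → setSeq-other W c λ i≡1+y → <-irrefl i≡1+y (s≤s i≤y)
        at : segment W′ y (suc y) ≡ c
        at = begin
          segment W′ y (suc y)         ≡⟨ segment-snoc W′ {y} ≤-refl ⟩
          segment W′ y y ∙ W′ (suc y)  ≡⟨ cong₂ _∙_ (segment-≤ W′ {y} ≤-refl) (setSeq-same W (suc y) c) ⟩
          e ∙ c                        ≡⟨ identityˡ c ⟩
          c                            ∎
        from-y : segment W′ y a ≡ c ∙ m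
        from-y = begin
          segment W′ y a                               ≡⟨ segment-split W′ (n≤1+n y) y<a ⟩
          segment W′ y (suc y) ∙ segment W′ (suc y) a  ≡⟨ cong₂ _∙_ at (segment-above ≤-refl) ⟩
          c ∙ m                                        ∎

      reach-below : ∀ {b} q → b ≤ y → q ∙ segment W′ b a ≡ (q ∙ segment W b y) ∙ (c ∙ m)
      reach-below q b≤y = trans (cong (q ∙_) (segment-below b≤y)) (sym (assoc _ _ _))

      source-below : ∀ {s b q} → b ≤ y → IsSource W′ a s (b , q) → s ∈M∙ c ∙ m
      source-below {b = b} {q} b≤y (_ , reach) = q ∙ segment W b y , trans (sym (reach-below q b≤y)) reach

      source-at-y : ∀ {s q} → q ∙ (c ∙ m) ≡ s → IsSource W′ a s (y , q)
      source-at-y {s} {q} reach = y≤a , trans (cong (q ∙_) (trans (segment-below ≤-refl)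
        (trans (cong (_∙ (c ∙ m)) (segment-≤ W {y} ≤-refl)) (identityˡ _)))) reach

      source-at-1+y : ∀ {s q} → IsSource W′ a s (suc y , q) ⇔ q ∙ m ≡ s
      source-at-1+y {s} {q} = mk⇔ (λ (_ , reach) → trans (cong (q ∙_) (sym (segment-above ≤-refl))) reach)
                                   (λ reach → y<a , trans (cong (q ∙_) (segment-above ≤-refl)) reach)

      not-below : ∀ {s c′} → ¬ s ∈M∙ c ∙ m → IsSource W′ a s c′ → suc y ≤ proj₁ c′
      not-below {c′ = b , q} ∉cm source with ℕₚ.<-cmp b (suc y)
      ... | tri< (s≤s b≤y) _ _ = contradiction (source-below b≤y source) ∉cm
      ... | tri≈ _ refl _      = ≤-refl
      ... | tri> _ _ y<b       = <⇒≤ y<b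

      not-at-or-below : ∀ {s c′} → ¬ s ∈M∙ c ∙ m → ¬ s ∈M∙ m → IsSource W′ a s c′ → suc y < proj₁ c′
      not-at-or-below {c′ = b , q} ∉cm ∉m source with m≤n⇒m<n∨m≡n (not-below ∉cm source)
      ... | inj₁ y<b  = y<b
      ... | inj₂ refl = contradiction (q , to source-at-1+y source) ∉m

      -- Such states have all their sources after the change.
      sources-above : ∀ {s} → ¬ s ∈M∙ c ∙ m → ¬ s ∈M∙ m → ∀ c′ → IsSource W a s c′ ⇔ IsSource W′ a s c′
      sources-above {s} ∉cm ∉m (b , q) = mk⇔ old⇒new new⇒old
        where
        new⇒old : IsSource W′ a s (b , q) → IsSource W a s (b , q)
        new⇒old source@(b≤a , reach) =
          b≤a , trans (cong (q ∙_) (sym (segment-above (<⇒≤ (not-at-or-below ∉cm ∉m source))))) reach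
        old⇒new : IsSource W a s (b , q) → IsSource W′ a s (b , q)
        old⇒new (b≤a , reach) with b ℕ.≤? suc y
        ... | no b≰1+y = b≤a , trans (cong (q ∙_) (segment-above (<⇒≤ (≰⇒> b≰1+y)))) reach
        ... | yes b≤1+y = contradiction (q ∙ segment W b (suc y) , (begin
          (q ∙ segment W b (suc y)) ∙ m    ≡⟨ assoc _ _ _ ⟩
          q ∙ (segment W b (suc y) ∙ m)    ≡⟨ cong (q ∙_) (sym (segment-split W b≤1+y y<a)) ⟩
          q ∙ segment W b a                ≡⟨ reach ⟩
          s                                ∎)) ∉m
          where open ≡-Reasoning

      older-above : ∀ {s₁ s₂} → ¬ s₁ ∈M∙ c ∙ m → ¬ s₁ ∈M∙ m → ¬ s₂ ∈M∙ c ∙ m → ¬ s₂ ∈M∙ m →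
                    older W a s₁ s₂ ⇔ older W′ a s₁ s₂
      older-above ∉cm₁ ∉m₁ ∉cm₂ ∉m₂ =
        mk⇔ (older-cong (sources-above ∉cm₁ ∉m₁) (sources-above ∉cm₂ ∉m₂))
            (older-cong (⇔-sym ∘ sources-above ∉cm₁ ∉m₁) (⇔-sym ∘ sources-above ∉cm₂ ∉m₂))

    module _ (ρ₁ ρ₂ : Elt → Elt) (ρ₁≗rank : ρ₁ ≗ rank W y) (ρ₂≗rank : ρ₂ ≗ rank W a) where

      private
        reachedFirst⇒older : ∀ {s₁ s₂} → ReachedFirst ρ₁ (c ∙ m) s₁ s₂ → older W′ a s₁ s₂
        reachedFirst⇒older {s₁} {s₂} (q₁ , reach₁ , first) =
          from (older⇔precedes W′ a s₁ s₂) (age W y q₁ , source , precedes)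
          where
          b₁≤y = proj₁ (age-source W y q₁)
          source : IsSource W′ a s₁ (age W y q₁)
          source = ≤-trans b₁≤y y≤a ,
                   trans (reach-below _ b₁≤y) (trans (cong (_∙ (c ∙ m)) (proj₂ (age-source W y q₁))) reach₁)
          precedes : ∀ c₂ → IsSource W′ a s₂ c₂ → age W y q₁ ≺ c₂
          precedes (b₂ , r₂) (_ , reach₂) with b₂ ℕ.≤? y
          ... | no b₂≰y  = inj₁ (≤-<-trans b₁≤y (≰⇒> b₂≰y))
          ... | yes b₂≤y = ≺-⪯-trans (rank<⇒older (subst₂ Fin._<_ (ρ₁≗rank q₁) (ρ₁≗rank _) (first _ reach)))
                                      (age-least W y _ (b₂ , r₂) (b₂≤y , refl))
            where
            reach : (r₂ ∙ segment W b₂ y) ∙ (c ∙ m) ≡ s₂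
            reach = trans (sym (reach-below r₂ b₂≤y)) reach₂

        older⇒reachedFirst : ∀ {s₁ s₂} → s₂ ∈M∙ c ∙ m → older W′ a s₁ s₂ → ReachedFirst ρ₁ (c ∙ m) s₁ s₂
        older⇒reachedFirst {s₁} {s₂} (q₀ , reach₀) o with to (older⇔precedes W′ a s₁ s₂) o
        ... | (b₁ , r₁) , (_ , reach₁) , precedes = r₁ ∙ segment W b₁ y , reach , first
          where
          b₁≤y : b₁ ≤ y
          b₁≤y = ⪯⇒≤ (≺⇒⪯ (precedes (y , q₀) (source-at-y reach₀)))
          reach : (r₁ ∙ segment W b₁ y) ∙ (c ∙ m) ≡ s₁
          reach = trans (sym (reach-below r₁ b₁≤y)) reach₁
          first : ∀ q₂ → q₂ ∙ (c ∙ m) ≡ s₂ → ρ₁ (r₁ ∙ segment W b₁ y) Fin.< ρ₁ q₂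
          first q₂ reach₂ = subst₂ Fin._<_ (sym (ρ₁≗rank _)) (sym (ρ₁≗rank q₂)) (older⇒rank<
            (from (older⇔precedes W y _ q₂) ((b₁ , r₁) , (b₁≤y , refl) , λ (b₂ , r₂) (b₂≤y , reach₂′) →
              precedes (b₂ , r₂) (≤-trans b₂≤y y≤a , trans (reach-below r₂ b₂≤y) (trans (cong (_∙ (c ∙ m)) reach₂′) reach₂)))))

        reachedFirstAt⇒older : ∀ {s₁ s₂} → ¬ s₂ ∈M∙ c ∙ m → ReachedFirst id m s₁ s₂ → older W′ a s₁ s₂
        reachedFirstAt⇒older {s₁} {s₂} ∉cm (q₁ , reach₁ , first) =
          from (older⇔precedes W′ a s₁ s₂) ((suc y , q₁) , from source-at-1+y reach₁ , precedes)
          where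
          precedes : ∀ c₂ → IsSource W′ a s₂ c₂ → (suc y , q₁) ≺ c₂
          precedes (b₂ , r₂) source with m≤n⇒m<n∨m≡n (not-below ∉cm source)
          ... | inj₁ y<b₂ = inj₁ y<b₂
          ... | inj₂ refl = inj₂ (refl , first r₂ (to source-at-1+y source))

        older⇒reachedFirstAt : ∀ {s₁ s₂} → ¬ s₁ ∈M∙ c ∙ m → s₂ ∈M∙ m → older W′ a s₁ s₂ → ReachedFirst id m s₁ s₂
        older⇒reachedFirstAt {s₁} {s₂} ∉cm (q₀ , reach₀) o with to (older⇔precedes W′ a s₁ s₂) o
        ... | (b₁ , r₁) , source , precedes
          with ≤-antisym (⪯⇒≤ (≺⇒⪯ (precedes (suc y , q₀) (from source-at-1+y reach₀)))) (not-below ∉cm source)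
        ... | refl = r₁ , to source-at-1+y source , λ q₂ reach₂ →
          state-order (precedes (suc y , q₂) (from source-at-1+y reach₂))
          where
          state-order : ∀ {q₂} → (suc y , r₁) ≺ (suc y , q₂) → r₁ Fin.< q₂
          state-order (inj₁ 1+y<1+y) = contradiction 1+y<1+y (<-irrefl refl)
          state-order (inj₂ (_ , r₁<q₂)) = r₁<q₂

      older-after-set : ∀ s₁ s₂ → older W′ a s₁ s₂ ⇔ OlderAfterSet ρ₁ ρ₂ m c s₁ s₂
      older-after-set s₁ s₂ = mk⇔ older⇒ ⇒older
        where
        older⇒ : older W′ a s₁ s₂ → OlderAfterSet ρ₁ ρ₂ m c s₁ s₂
        older⇒ o with s₂ ∈M∙? c ∙ m | s₁ ∈M∙? c ∙ m
        ... | yes ∈cm₂ | _                 = inj₁ (older⇒reachedFirst ∈cm₂ o)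
        ... | no ∉cm₂  | yes (q₁ , reach₁) = inj₁ (q₁ , reach₁ , λ q₂ reach₂ → contradiction (q₂ , reach₂) ∉cm₂)
        ... | no ∉cm₂  | no ∉cm₁           = inj₂ (∉cm₁ , ∉cm₂ , later)
          where
          later : ReachedFirst id m s₁ s₂ ⊎ (¬ s₁ ∈M∙ m × ¬ s₂ ∈M∙ m × ρ₂ s₁ Fin.< ρ₂ s₂)
          later with s₂ ∈M∙? m | s₁ ∈M∙? m
          ... | yes ∈m₂ | _                 = inj₁ (older⇒reachedFirstAt ∉cm₁ ∈m₂ o)
          ... | no ∉m₂  | yes (q₁ , reach₁) = inj₁ (q₁ , reach₁ , λ q₂ reach₂ → contradiction (q₂ , reach₂) ∉m₂)
          ... | no ∉m₂  | no ∉m₁            = inj₂ (∉m₁ , ∉m₂ , subst₂ Fin._<_ (sym (ρ₂≗rank s₁)) (sym (ρ₂≗rank s₂))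
                                                  (older⇒rank< (from (older-above ∉cm₁ ∉m₁ ∉cm₂ ∉m₂) o)))
        ⇒older : OlderAfterSet ρ₁ ρ₂ m c s₁ s₂ → older W′ a s₁ s₂
        ⇒older (inj₁ first) = reachedFirst⇒older first
        ⇒older (inj₂ (_ , ∉cm₂ , inj₁ first)) = reachedFirstAt⇒older ∉cm₂ first
        ⇒older (inj₂ (∉cm₁ , ∉cm₂ , inj₂ (∉m₁ , ∉m₂ , ρ₂<))) =
          to (older-above ∉cm₁ ∉m₁ ∉cm₂ ∉m₂) (rank<⇒older (subst₂ Fin._<_ (ρ₂≗rank s₁) (ρ₂≗rank s₂) ρ₂<))

      rank-after-set : ∀ s → toℕ (rank W′ a s) ≡ rankAfterSet ρ₁ ρ₂ m c s
      rank-after-set s = rank-count W′ a s (λ s′ → olderAfterSet? ρ₁ ρ₂ m c s′ s) (λ s′ → older-after-set s′ s)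

module Runs (M : FinMonoid) where
  open FinMonoid M
  open Segments M
  open Ranks M

  Step : Seq → ℕ → Elt → Elt → Set
  Step W zero    r r′ = ⊥
  Step W (suc y) r r′ = Σ Elt λ s → rank W y s ≡ r × rank W (suc y) (s ∙ W (suc y)) ≡ r′

  step? : ∀ W z r r′ → Dec (Step W z r r′)
  step? W zero    r r′ = no λ ()
  step? W (suc y) r r′ = any? λ s → (rank W y s Fin.≟ r) ×-dec (rank W (suc y) (s ∙ W (suc y)) Fin.≟ r′)

  Steady : Seq → Elt → ℕ → ℕ → Set
  Steady W r lo hi = ∀ t → lo < t → t < hi → Step W t r r

  step-unit : ∀ z r r′ → Step (λ _ → e) z r r′ ⇔ (r ≡ r′ × 0 < z)
  step-unit zero    r r′ = mk⇔ (λ ()) λ { (_ , ()) }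
  step-unit (suc y) r r′ = mk⇔
    (λ (s , rank-y , rank-z) → trans (sym rank-y) (trans (rank-unit y s) (trans (sym (identityʳ s))
                                 (trans (sym (rank-unit (suc y) (s ∙ e))) rank-z))) , s≤s z≤n)
    (λ { (refl , _) → r , rank-unit y r , trans (rank-unit (suc y) (r ∙ e)) (identityʳ r) })

  step-functional : ∀ {W z r r₁ r₂} → Step W z r r₁ → Step W z r r₂ → r₁ ≡ r₂
  step-functional {z = suc y} (s₁ , rank₁ , rank₁′) (s₂ , rank₂ , rank₂′)
    with rank-injective (trans rank₁ (sym rank₂))
  ... | refl = trans (sym rank₁′) rank₂′

  module _ (W : Seq) (y₀ : ℕ) (σ : Elt) where

    track : ℕ → Elt
    track z = σ ∙ segment W y₀ z

    track-start : track y₀ ≡ σ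
    track-start = trans (cong (σ ∙_) (segment-≤ W {y₀} ≤-refl)) (identityʳ σ)

    track-snoc : ∀ {z} → y₀ ≤ z → track (suc z) ≡ track z ∙ W (suc z)
    track-snoc y₀≤z = trans (cong (σ ∙_) (segment-snoc W y₀≤z)) (sym (assoc _ _ _))

    track-restart : ∀ {y₁ u} → y₀ ≤ y₁ → y₁ ≤ u → track y₁ ∙ segment W y₁ u ≡ track u
    track-restart y₀≤y₁ y₁≤u = trans (assoc _ _ _) (cong (σ ∙_) (sym (segment-split W y₀≤y₁ y₁≤u)))

    step-track : ∀ {z} → y₀ ≤ z → Step W (suc z) (rank W z (track z)) (rank W (suc z) (track (suc z)))
    step-track y₀≤z = track _ , refl , cong (rank W (suc _)) (sym (track-snoc y₀≤z))

    rank-track-antitone : ∀ {z} → y₀ ≤ z → rank W (suc z) (track (suc z)) Fin.≤ rank W z (track z)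
    rank-track-antitone {z} y₀≤z rewrite track-snoc y₀≤z = rank-antitone W z (track z)

    KeepsRank : Elt → ℕ → Set
    KeepsRank R t₁ = ∀ t → y₀ ≤ t → t < t₁ → rank W t (track t) ≡ R

    keeps-rank : ∀ {R t₁} → rank W y₀ σ ≡ R → Steady W R y₀ t₁ → KeepsRank R t₁
    keeps-rank rank₀ steady t y₀≤t t<t₁ with m≤n⇒m<n∨m≡n y₀≤t
    ... | inj₂ refl = trans (cong (rank W y₀) track-start) rank₀
    keeps-rank rank₀ steady (suc t) _ t<t₁ | inj₁ (s≤s y₀≤t) = step-functional step-at-t (steady (suc t) (s≤s y₀≤t) t<t₁)
      where
      step-at-t = subst (λ r → Step W (suc t) r _) (keeps-rank rank₀ steady t y₀≤t (<-trans (n<1+n t) t<t₁)) (step-track y₀≤t)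

    step-at-drop : ∀ {R t₁} → y₀ < t₁ → KeepsRank R t₁ → Step W t₁ R (rank W t₁ (track t₁))
    step-at-drop {t₁ = suc t} (s≤s y₀≤t) keeps =
      subst (λ r → Step W (suc t) r _) (keeps t y₀≤t ≤-refl) (step-track y₀≤t)

    steady-while-keeping : ∀ {R t₁} → KeepsRank R t₁ → Steady W R y₀ t₁
    steady-while-keeping keeps t y₀<t t<t₁ =
      subst (Step W t _) (keeps t (<⇒≤ y₀<t) t<t₁)
            (step-at-drop y₀<t λ t′ y₀≤t′ t′<t → keeps t′ y₀≤t′ (<-trans t′<t t<t₁))

    rank-at-drop : ∀ {R r′ t₁} → y₀ < t₁ → KeepsRank R t₁ → Step W t₁ R r′ → rank W t₁ (track t₁) ≡ r′
    rank-at-drop y₀<t₁ keeps step = step-functional (step-at-drop y₀<t₁ keeps) step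

    keeps-one-more : ∀ {R u} → KeepsRank R u → rank W u (track u) ≡ R → KeepsRank R (suc u)
    keeps-one-more keeps same t y₀≤t t<1+u with m≤n⇒m<n∨m≡n (≤-pred t<1+u)
    ... | inj₁ t<u  = keeps t y₀≤t t<u
    ... | inj₂ refl = same

    -- Ranks along a run can only decrease, so a run either keeps its rank up to u or first drops.
    keeps-or-drops : ∀ {R} u → y₀ ≤ u → rank W y₀ σ ≡ R →
                     KeepsRank R (suc u) ⊎ Σ ℕ λ t₁ → y₀ < t₁ × t₁ ≤ u × rank W t₁ (track t₁) Fin.< R × KeepsRank R t₁
    keeps-or-drops u y₀≤u rank₀ with m≤n⇒m<n∨m≡n y₀≤u
    keeps-or-drops u y₀≤u rank₀ | inj₂ refl = inj₁ (keeps-rank rank₀ λ t y₀<t t<1+y₀ → contradiction (≤-pred t<1+y₀) (<⇒≱ y₀<t))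
    keeps-or-drops zero y₀≤u rank₀ | inj₁ ()
    keeps-or-drops {R} (suc u) _ rank₀ | inj₁ (s≤s y₀≤u) with keeps-or-drops u y₀≤u rank₀
    ... | inj₂ (t₁ , y₀<t₁ , t₁≤u , dropped , keeps) =
      inj₂ (t₁ , y₀<t₁ , ≤-trans t₁≤u (n≤1+n u) , dropped , keeps)
    ... | inj₁ keeps with rank W (suc u) (track (suc u)) Fin.≟ R
    ...   | yes same = inj₁ (keeps-one-more keeps same)
    ...   | no differ = inj₂ (suc u , s≤s y₀≤u , ≤-refl , Finₚ.≤∧≢⇒< below differ , keeps)
      where below = subst (rank W (suc u) (track (suc u)) Fin.≤_) (keeps u y₀≤u ≤-refl) (rank-track-antitone y₀≤u)

module Words (M : FinMonoid) where
  open FinMonoid M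
  open Segments M
  open Ranks M

  -- positions outside the word carry the identity
  toSeq : ∀ {n} → Word size n → Seq
  toSeq {n} w t with t ℕ.<? n
  ... | yes t<n = w (fromℕ< t<n)
  ... | no _    = e

  toSeq-toℕ : ∀ {n} (w : Word size n) x → toSeq w (toℕ x) ≡ w x
  toSeq-toℕ {n} w x with toℕ x ℕ.<? n
  ... | yes x<n = cong w (fromℕ<-toℕ x x<n)
  ... | no x≮n  = contradiction (toℕ<n x) x≮n

  toSeq-initWord : ∀ n t → toSeq (initWord M n) t ≡ e
  toSeq-initWord n t with t ℕ.<? n
  ... | yes _ = refl
  ... | no _  = refl

  toSeq-cong : ∀ {n} (w w′ : Word size n) t → (∀ x → toℕ x ≡ t → w x ≡ w′ x) → toSeq w t ≡ toSeq w′ t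
  toSeq-cong {n} w w′ t agree with t ℕ.<? n
  ... | yes t<n = agree (fromℕ< t<n) (toℕ-fromℕ< t<n)
  ... | no _    = refl

  toSeq-setWord : ∀ {n} (w : Word size n) c i t → toSeq (setWord M w c i) t ≡ setSeq (toSeq w) (toℕ i) c t
  toSeq-setWord w c i t with t ℕ.≟ toℕ i
  ... | yes refl = trans (toSeq-toℕ (setWord M w c i) i) (trans set-here (sym (setSeq-same (toSeq w) (toℕ i) c)))
    where
    set-here : setWord M w c i i ≡ c
    set-here with i Fin.≟ i
    ... | yes _  = refl
    ... | no i≢i = contradiction refl i≢i
  ... | no t≢i = trans (toSeq-cong (setWord M w c i) w t set-elsewhere) (sym (setSeq-other (toSeq w) c t≢i))
    where
    set-elsewhere : ∀ x → toℕ x ≡ t → setWord M w c i x ≡ w x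
    set-elsewhere x x≡t with i Fin.≟ x
    ... | yes refl = contradiction (sym x≡t) t≢i
    ... | no _     = refl

  private
    prepend-if : ∀ {A : Set} → Dec A → Elt → Elt → Elt
    prepend-if (yes _) x r = x ∙ r
    prepend-if (no _)  x r = r

  prodWhere : ∀ {P : ℕ → Set} → Decidable P → Seq → ℕ → Elt
  prodWhere P? W zero    = e
  prodWhere P? W (suc N) = prepend-if (P? 0) (W 0) (prodWhere (P? ∘ suc) (W ∘ suc) N)

  prodWhere-filter : ∀ {n N} (w : Word size n) (f : Fin N → Fin n) {P : Fin n → Set} {Q : ℕ → Set}
                     (P? : Decidable P) (Q? : Decidable Q) W → (∀ i → P (f i) ⇔ Q (toℕ i)) → (∀ i → w (f i) ≡ W (toℕ i)) →
                     foldr (λ i acc → w i ∙ acc) e (filter P? (tabulate f)) ≡ prodWhere Q? W N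
  prodWhere-filter {N = zero}  w f P? Q? W P⇔Q letters = refl
  prodWhere-filter {N = suc N} w f P? Q? W P⇔Q letters with P? (f zero) | Q? 0
  ... | yes _ | yes _ = cong₂ _∙_ (letters zero) rest
    where rest = prodWhere-filter w (f ∘ suc) P? (Q? ∘ suc) (W ∘ suc) (P⇔Q ∘ suc) (letters ∘ suc)
  ... | no _  | no _  = prodWhere-filter w (f ∘ suc) P? (Q? ∘ suc) (W ∘ suc) (P⇔Q ∘ suc) (letters ∘ suc)
  ... | yes p | no ¬q = contradiction (to (P⇔Q zero) p) ¬q
  ... | no ¬p | yes q = contradiction (from (P⇔Q zero) q) ¬p

  prodWhere-interval : ∀ N W {Q : ℕ → Set} (Q? : Decidable Q) lo hi → hi ≤ N → (∀ t → Q t ⇔ (lo ≤ t × t < hi)) →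
                       prodWhere Q? W N ≡ prod W lo (hi ∸ lo)
  prodWhere-interval zero    W Q? lo .zero z≤n Q⇔ = cong (prod W lo) (sym (ℕₚ.0∸n≡0 lo))
  prodWhere-interval (suc N) W {Q} Q? lo hi hi≤1+N Q⇔ =
    trans (cong (prepend-if (Q? 0) (W 0)) rest) (first-letter (Q? 0) lo hi (Q⇔ 0))
    where
    interval-suc : ∀ t → (lo ≤ suc t × suc t < hi) ⇔ (ℕ.pred lo ≤ t × t < ℕ.pred hi)
    interval-suc t = mk⇔ (λ (lo≤1+t , 1+t<hi) → ℕₚ.pred-mono-≤ lo≤1+t , ℕₚ.pred-mono-≤ 1+t<hi)
                         (λ (≤t , t<) → from-pred lo ≤t , to-pred hi t<)
      where
      from-pred : ∀ lo → ℕ.pred lo ≤ t → lo ≤ suc t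
      from-pred zero    _    = z≤n
      from-pred (suc l) l≤t = s≤s l≤t
      to-pred : ∀ hi → t < ℕ.pred hi → suc t < hi
      to-pred (suc h) t<h = s≤s t<h
    rest : prodWhere (Q? ∘ suc) (W ∘ suc) N ≡ prod (W ∘ suc) (ℕ.pred lo) (ℕ.pred hi ∸ ℕ.pred lo)
    rest = prodWhere-interval N (W ∘ suc) (Q? ∘ suc) (ℕ.pred lo) (ℕ.pred hi) (ℕₚ.pred-mono-≤ hi≤1+N)
                              λ t → ⇔-trans (Q⇔ (suc t)) (interval-suc t)
    first-letter : ∀ (q? : Dec (Q 0)) lo hi → Q 0 ⇔ (lo ≤ 0 × 0 < hi) →
                   prepend-if q? (W 0) (prod (W ∘ suc) (ℕ.pred lo) (ℕ.pred hi ∸ ℕ.pred lo)) ≡ prod W lo (hi ∸ lo)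
    first-letter (yes q) lo hi Q₀⇔ with to Q₀⇔ q
    ... | z≤n , s≤s {n = h} _ = cong (W 0 ∙_) (prod-shift W 0 h)
    first-letter (no ¬q) zero     zero     Q₀⇔ = refl
    first-letter (no ¬q) zero     (suc hi) Q₀⇔ = contradiction (from Q₀⇔ (z≤n , s≤s z≤n)) ¬q
    first-letter (no ¬q) (suc lo) zero     Q₀⇔ = cong (prod (W ∘ suc) lo) (ℕₚ.0∸n≡0 lo)
    first-letter (no ¬q) (suc lo) (suc hi) Q₀⇔ = prod-shift W lo (hi ∸ lo)

  infixValue≡between : ∀ {n} (w : Word size n) j k → infixValue M w j k ≡ between (toSeq w) (toℕ j) (toℕ k)
  infixValue≡between {n} w j k =
    trans (prodWhere-filter w id _ inside? (toSeq w) (λ _ → ⇔-id _) (λ i → sym (toSeq-toℕ w i)))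
          (prodWhere-interval n (toSeq w) inside? (suc (toℕ j)) (toℕ k) (<⇒≤ (toℕ<n k)) (λ _ → ⇔-id _))
    where
    inside? : ∀ t → Dec (toℕ j < t × t < toℕ k)
    inside? t = (toℕ j ℕ.<? t) ×-dec (t ℕ.<? toℕ k)

module Program (M : FinMonoid) where
  open FinMonoid M
  open Segments M
  open Ranks M
  open AfterSet M
  open Runs M

  data Symbol : Set where
    rankIs stepIs : Elt → Elt → Symbol

  #symbols : ℕ
  #symbols = size * size + size * size

  encode : Symbol → Fin #symbols
  encode (rankIs s r)  = join (size * size) (size * size) (inj₁ (combine s r))
  encode (stepIs r r′) = join (size * size) (size * size) (inj₂ (combine r r′))

  decode : Fin #symbols → Symbol
  decode i = [ from-pair rankIs , from-pair stepIs ]′ (splitAt (size * size) i)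
    where
    from-pair : (Elt → Elt → Symbol) → Fin (size * size) → Symbol
    from-pair symbol = uncurry symbol ∘ remQuot size

  decode-encode : ∀ x → decode (encode x) ≡ x
  decode-encode (rankIs s r)  = trans (cong [ _ , _ ]′ (splitAt-join (size * size) (size * size) (inj₁ (combine s r))))
                                      (cong (uncurry rankIs) (remQuot-combine s r))
  decode-encode (stepIs r r′) = trans (cong [ _ , _ ]′ (splitAt-join (size * size) (size * size) (inj₂ (combine r r′))))
                                      (cong (uncurry stepIs) (remQuot-combine r r′))

  -- the intended meaning of the auxiliary relations at position z of W
  Holds : Seq → Symbol → ℕ → Set
  Holds W (rankIs s r)  z = rank W z s ≡ r
  Holds W (stepIs r r′) z = Step W z r r′

  holds? : ∀ W x z → Dec (Holds W x z)
  holds? W (rankIs s r)  z = rank W z s Fin.≟ r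
  holds? W (stepIs r r′) z = step? W z r r′

  open Prenex {size} {#symbols}

  private variable v : ℕ

  hasRank : Elt → Elt → Fin v → Σ₂ v
  hasRank s r x = atom (aux (encode (rankIs s r)) x) (aux _ x)

  stepsTo : Elt → Elt → Fin v → Σ₂ v
  stepsTo r r′ x = atom (aux (encode (stepIs r r′)) x) (aux _ x)

  lt : Fin v → Fin v → FO size #symbols v
  lt x y = neg (leq y x)

  infix 7 _<′_ _≤′_ _≐_

  _<′_ _≤′_ _≐_ : Fin v → Fin v → Σ₂ v
  x <′ y = atom (lt x y) (neg (leq y x))
  x ≤′ y = atom (leq x y) (leq x y)
  x ≐ y  = atom (eq x y) (eq x y)

  letterAt : Elt → Fin v → Σ₂ v
  letterAt l x = atom (letter l x) (letter l x)

  first : Fin v → Σ₂ v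
  first p = ∀qf (leq (suc p) zero) (leq _ _)

  adjacent : Fin v → Fin v → Σ₂ v
  adjacent j k = ∀qf (neg (and (lt (suc j) zero) (lt zero (suc k))))
                     (neg (and (neg (leq _ _)) (neg (leq _ _))))

  successor : Fin v → Fin v → Σ₂ v
  successor y p = y <′ p ∧₂ adjacent y p

  steadyWhere : Elt → (inside : FO size #symbols (suc v)) → IsQF inside → Σ₂ v
  steadyWhere r inside q = ∀qf (or (neg inside) (aux (encode (stepIs r r)) zero))
                               (or (neg q) (aux _ zero))

  -- The run of the state with rank r at y is in state x at u, with at most f drops of rank.
  reaches : Elt → ℕ → Elt → Fin v → Fin v → Σ₂ v
  stays : Elt → Elt → Fin v → Fin v → Σ₂ v
  drops : Elt → ℕ → Elt → Fin v → Fin v → Σ₂ v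

  reaches x zero    r y u = stays x r y u
  reaches x (suc f) r y u = stays x r y u ∨₂ drops x f r y u

  stays x r y u =
    steadyWhere r (and (lt (suc y) zero) (leq zero (suc u))) (and (neg (leq _ _)) (leq _ _)) ∧₂
    hasRank x r u

  -- the first drop, at y′ ∈ (y, u], is to some rank r′ < r
  drops x f r y u = ⋁ size λ r′ → fromDec (r′ Fin.<? r) ∧₂ ∃₂
    (suc y <′ zero ∧₂ zero ≤′ suc u ∧₂
     steadyWhere r (and (lt (suc (suc y)) zero) (lt zero (suc zero))) (and (neg (leq _ _)) (neg (leq _ _))) ∧₂
     stepsTo r r′ zero ∧₂ reaches x f r′ zero (suc u))

  -- the run from e at j is in state x at k − 1
  runBetween : Elt → Fin v → Fin v → Σ₂ v
  runBetween x j k = ∃₂ (successor zero (suc k) ∧₂ suc j <′ zero ∧₂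
                         ⋁ size λ r → hasRank e r (suc j) ∧₂ reaches x size r (suc j) zero)

  valueBetween : Elt → Fin v → Fin v → Σ₂ v
  valueBetween x j k = (fromDec (x Fin.≟ e) ∧₂ adjacent j k) ∨₂ runBetween x j k

  withRanksOf : ∀ {l} → Fin v → Vec Elt l → (Vec Elt l → Σ₂ v) → Σ₂ v
  withRanksOf x []       G = G []
  withRanksOf x (s ∷ ss) G = ⋁ size λ r → hasRank s r x ∧₂ withRanksOf x ss (G ∘ (r ∷_))

  withRanksAt : Fin v → (Vec Elt size → Σ₂ v) → Σ₂ v
  withRanksAt x = withRanksOf x (Vec.allFin size)

  withSegment : Fin v → Fin v → (Elt → Σ₂ v) → Σ₂ v
  withSegment a p G = (a ≐ p ∧₂ G e) ∨₂
    (p <′ a ∧₂ ⋁ size λ m′ → valueBetween m′ p a ∧₂ ⋁ size λ l → letterAt l a ∧₂ G (m′ ∙ l))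

  -- after setting p = y + 1 to c, for p ≤ a: the rank of s at a is r, computed from the old ranks at y and a
  recomputedRank : Elt → Elt → Elt → Fin v → Fin v → Fin v → Σ₂ v
  recomputedRank c s r y a p = withRanksAt y λ ρ₁ → withSegment a p λ m → withRanksAt a λ ρ₂ →
    fromDec (rankAfterSet (Vec.lookup ρ₁) (Vec.lookup ρ₂) m c s ℕ.≟ toℕ r)

  rankAfter : Elt → Elt → Elt → Fin v → Fin v → Σ₂ v
  rankAfter c s r a p = (first p ∧₂ hasRank s r a) ∨₂ (a <′ p ∧₂ hasRank s r a) ∨₂
    ∃₂ (successor zero (suc p) ∧₂ suc p ≤′ suc a ∧₂ recomputedRank c s r zero (suc a) (suc p))

  stepAfter : Elt → Elt → Elt → Fin v → Fin v → Σ₂ v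
  stepAfter c r r′ a p = ∃₂ (successor zero (suc a) ∧₂ ⋁ size λ s →
    rankAfter c s r zero (suc p) ∧₂ ⋁ size λ l → letterAt l (suc a) ∧₂ rankAfter c (s ∙ l) r′ (suc a) (suc p))

  updateFormula : Elt → Symbol → Σ₂ 2
  updateFormula c (rankIs s r)  = rankAfter c s r zero (suc zero)
  updateFormula c (stepIs r r′) = stepAfter c r r′ zero (suc zero)

  private
    truth : ∀ {P : Set} → Dec P → FO size 0 1
    truth (yes _) = tru
    truth (no _)  = fls

    truth-sat : ∀ {n} {P : Set} (P? : Dec P) {ρ : Fin 1 → Fin n} → Sat (initWord M n) noAux (truth P?) ρ ⇔ P
    truth-sat (yes p) = mk⇔ (λ _ → p) (λ _ → _)
    truth-sat (no ¬p) = mk⇔ (λ ()) ¬p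

  -- in the word of identities, ranks are the identity and every position but the first steps r to r
  initFormula : Symbol → FO size 0 1
  initFormula (rankIs s r)  = truth (s Fin.≟ r)
  initFormula (stepIs r r′) = and (truth (r Fin.≟ r′)) (ex (neg (leq (suc zero) zero)))

  init-sat : ∀ {n} x (a : Fin n) → Sat (initWord M n) noAux (initFormula x) (single a) ⇔ Holds (λ _ → e) x (toℕ a)
  init-sat (rankIs s r)  a =
    ⇔-trans (truth-sat (s Fin.≟ r)) (mk⇔ (trans (rank-unit (toℕ a) s)) (trans (sym (rank-unit (toℕ a) s))))
  init-sat {n} (stepIs r r′) a = ⇔-trans (truth-sat (r Fin.≟ r′) ×-⇔ not-first) (⇔-sym (step-unit (toℕ a) r r′))
    where
    not-first : (Σ (Fin n) λ y → ¬ a Fin.≤ y) ⇔ 0 < toℕ a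
    not-first = mk⇔ (λ (y , a≰y) → ≤-<-trans z≤n (≰⇒> a≰y))
                    λ 0<a → fromℕ< (≤-<-trans z≤n (toℕ<n a)) ,
                            λ a≤0 → <⇒≱ 0<a (subst (toℕ a ≤_) (toℕ-fromℕ< _) a≤0)

  program : DynProg size #symbols
  program = record { update = λ i c → ⌜ updateFormula c (decode i) ⌝ ; init = initFormula ∘ decode }

  Represents : ∀ {n} → Seq → AuxState #symbols n → Set
  Represents W A = ∀ i a → A i a ⇔ Holds W (decode i) (toℕ a)

  SetAt : ∀ {n} → Word size n → Seq → ℕ → Elt → Set
  SetAt w W p c = ∀ x → w x ≡ setSeq W p c (toℕ x)

  -- Letters are read from w while A represents W: during an update, w is already the new word and A still
  -- describes the old one.
  module Meaning {n} (w : Word size n) (A : AuxState #symbols n) (W : Seq) (represents : Represents W A) (default : Fin n)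
    where

    open Semantics w A (λ i a → Dec.map (⇔-sym (represents i a)) (holds? W (decode i) (toℕ a))) default public

    infix 10 _!_
    _!_ : Env v → Fin v → ℕ
    ρ ! x = toℕ (ρ x)

    private
      position : ∀ {t} → t < n → Fin n
      position t<n = fromℕ< t<n

      predecessor : ∀ (p : Fin n) → toℕ p ≢ 0 → Σ (Fin n) λ y → suc (toℕ y) ≡ toℕ p
      predecessor p p≢0 with toℕ p | toℕ<n p
      ... | zero    | _       = contradiction refl p≢0
      ... | suc t   | 1+t<n   = position (<-trans ≤-refl 1+t<n) , cong suc (toℕ-fromℕ< _)

      aux-sat : ∀ sym (a : Fin n) → A (encode sym) a ⇔ Holds W sym (toℕ a)
      aux-sat sym a = subst (λ sym′ → A (encode sym) a ⇔ Holds W sym′ (toℕ a)) (decode-encode sym) (represents (encode sym) a)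

    hasRank-sat : ∀ s r (x : Fin v) ρ → ⟦ hasRank s r x ⟧ ρ ⇔ rank W (ρ ! x) s ≡ r
    hasRank-sat s r x ρ = aux-sat (rankIs s r) (ρ x)

    stepsTo-sat : ∀ r r′ (x : Fin v) ρ → ⟦ stepsTo r r′ x ⟧ ρ ⇔ Step W (ρ ! x) r r′
    stepsTo-sat r r′ x ρ = aux-sat (stepIs r r′) (ρ x)

    <′-sat : ∀ (x y : Fin v) ρ → ⟦ x <′ y ⟧ ρ ⇔ ρ ! x < ρ ! y
    <′-sat x y ρ = mk⇔ ≰⇒> <⇒≱

    first-sat : ∀ (p : Fin v) ρ → ⟦ first p ⟧ ρ ⇔ ρ ! p ≡ 0
    first-sat p ρ = mk⇔ (λ p-first → ℕₚ.n≤0⇒n≡0 (subst (ρ ! p ≤_) (toℕ-fromℕ< _) (p-first (position 0<n))))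
                        (λ p≡0 a → subst (_≤ toℕ a) (sym p≡0) z≤n)
      where 0<n = ≤-<-trans z≤n (toℕ<n (ρ p))

    adjacent-sat : ∀ (j k : Fin v) ρ → ⟦ adjacent j k ⟧ ρ ⇔ ρ ! k ≤ suc (ρ ! j)
    adjacent-sat j k ρ = mk⇔ ⇒k≤ k≤⇒
      where
      ⇒k≤ : ⟦ adjacent j k ⟧ ρ → ρ ! k ≤ suc (ρ ! j)
      ⇒k≤ none = ≮⇒≥ λ 1+j<k → none (position (<-trans 1+j<k (toℕ<n (ρ k))))
        (<⇒≱ (subst (ρ ! j <_) (sym (toℕ-fromℕ< _)) ≤-refl) ,
         <⇒≱ (subst (_< ρ ! k) (sym (toℕ-fromℕ< _)) 1+j<k))
      k≤⇒ : ρ ! k ≤ suc (ρ ! j) → ⟦ adjacent j k ⟧ ρ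
      k≤⇒ k≤1+j z (z≰j , k≰z) = <-irrefl refl (<-≤-trans (≤-<-trans k≤1+j (s≤s (≰⇒> z≰j))) (≰⇒> k≰z))

    successor-sat : ∀ (y p : Fin v) ρ → ⟦ successor y p ⟧ ρ ⇔ suc (ρ ! y) ≡ ρ ! p
    successor-sat y p ρ = ⇔-trans (∧₂-sat (y <′ p) (adjacent y p))
      (mk⇔ (λ (y<p , adj) → ≤-antisym (to (<′-sat y p ρ) y<p) (to (adjacent-sat y p ρ) adj))
           (λ 1+y≡p → from (<′-sat y p ρ) (≤-reflexive 1+y≡p) , from (adjacent-sat y p ρ) (≤-reflexive (sym 1+y≡p))))

    private
      steadyWhere-sat : ∀ {r lo hi} (inside : FO size #symbols (suc v)) q {ρ} → hi ≤ n →
                        (∀ z → Sat w A inside (extend z ρ) ⇔ (lo < toℕ z × toℕ z < hi)) →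
                        ⟦ steadyWhere r inside q ⟧ ρ ⇔ Steady W r lo hi
      steadyWhere-sat {r = r} {lo} {hi} inside q {ρ} hi≤n inside⇔ = mk⇔ ⇒steady steady⇒
        where
        ⇒steady : ⟦ steadyWhere r inside q ⟧ ρ → Steady W r lo hi
        ⇒steady steps t lo<t t<hi with steps (position (<-≤-trans t<hi hi≤n)) | toℕ-fromℕ< (<-≤-trans t<hi hi≤n)
        ... | inj₁ outside | z≡t = contradiction (from (inside⇔ _) (subst (lo <_) (sym z≡t) lo<t , subst (_< hi) (sym z≡t) t<hi)) outside
        ... | inj₂ step    | z≡t = subst (λ t′ → Step W t′ r r) z≡t (to (aux-sat (stepIs r r) _) step)
        steady⇒ : Steady W r lo hi → ⟦ steadyWhere r inside q ⟧ ρ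
        steady⇒ steady z with sat? inside (extend z ρ)
        ... | no outside = inj₁ outside
        ... | yes within = inj₂ (from (aux-sat (stepIs r r) z) (uncurry (steady (toℕ z)) (to (inside⇔ z) within)))

    stays-sat : ∀ x r (y u : Fin v) {ρ} →
                ⟦ stays x r y u ⟧ ρ ⇔ (Steady W r (ρ ! y) (suc (ρ ! u)) × rank W (ρ ! u) x ≡ r)
    stays-sat x r y u {ρ} = ⇔-trans (∧₂-sat _ (hasRank x r u))
      (steadyWhere-sat (and (lt (suc y) zero) (leq zero (suc u))) (and (neg (leq _ _)) (leq _ _)) {ρ} (toℕ<n (ρ u))
         (λ z → mk⇔ (λ (z≰y , z≤u) → ≰⇒> z≰y , s≤s z≤u) (λ (y<z , z<1+u) → <⇒≱ y<z , ≤-pred z<1+u))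
       ×-⇔ hasRank-sat x r u ρ)

    Drop : Elt → ℕ → Elt → Fin v → Fin v → Env v → Set
    Drop x f r y u ρ = Σ Elt λ r′ → r′ Fin.< r × Σ (Fin n) λ y′ → ρ ! y < toℕ y′ × toℕ y′ ≤ ρ ! u ×
      Steady W r (ρ ! y) (toℕ y′) × Step W (toℕ y′) r r′ × ⟦ reaches x f r′ zero (suc u) ⟧ (extend y′ ρ)

    drops-sat : ∀ x f r (y u : Fin v) {ρ} → ⟦ drops x f r y u ⟧ ρ ⇔ Drop x f r y u ρ
    drops-sat x f r y u {ρ} = ⇔-trans (⋁-sat size _) (∃-cong λ r′ → ⇔-trans (∧₂-sat (fromDec (r′ Fin.<? r)) _)
      (fromDec-sat (r′ Fin.<? r) ×-⇔ ∃-cong λ y′ → let ρ′ = extend y′ ρ in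
        ⇔-trans (∧₂-sat _ _) (<′-sat (suc y) zero ρ′ ×-⇔ ⇔-trans (∧₂-sat _ _) (⇔-id _ ×-⇔
        ⇔-trans (∧₂-sat _ _) (steadyWhere-sat inside (and (neg (leq _ _)) (neg (leq _ _))) {ρ′} (<⇒≤ (toℕ<n y′))
            (λ z → mk⇔ (λ (z≰y , y′≰z) → ≰⇒> z≰y , ≰⇒> y′≰z) (λ (y<z , z<y′) → <⇒≱ y<z , <⇒≱ z<y′))
          ×-⇔ ⇔-trans (∧₂-sat _ _) (stepsTo-sat r r′ zero ρ′ ×-⇔ ⇔-id _))))))
      where
      inside : FO size #symbols (suc (suc _))
      inside = and (lt (suc (suc y)) zero) (lt zero (suc zero))

    reaches-sound : ∀ x f r (y u : Fin v) {ρ} → ⟦ reaches x f r y u ⟧ ρ →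
                    ∀ σ → ρ ! y ≤ ρ ! u → rank W (ρ ! y) σ ≡ r → track W (ρ ! y) σ (ρ ! u) ≡ x
    reaches-sound x f r y u {ρ} reach σ y≤u rank₀ = go f reach
      where
      from-stays : ⟦ stays x r y u ⟧ ρ → track W (ρ ! y) σ (ρ ! u) ≡ x
      from-stays here =
        let steady , rank-x = to (stays-sat x r y u) here
        in rank-injective (trans (keeps-rank W (ρ ! y) σ rank₀ steady (ρ ! u) y≤u ≤-refl) (sym rank-x))
      from-drops : ∀ {f} → ⟦ drops x f r y u ⟧ ρ → track W (ρ ! y) σ (ρ ! u) ≡ x
      from-drops {f} dropping =
        let r′ , _ , y′ , y<y′ , y′≤u , steady , step , reach′ = to (drops-sat x f r y u) dropping
        in trans (sym (track-restart W (ρ ! y) σ (<⇒≤ y<y′) y′≤u))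
                 (reaches-sound x f r′ zero (suc u) reach′ (track W (ρ ! y) σ (toℕ y′)) y′≤u
                   (rank-at-drop W (ρ ! y) σ y<y′ (keeps-rank W (ρ ! y) σ rank₀ steady) step))
      go : ∀ f → ⟦ reaches x f r y u ⟧ ρ → track W (ρ ! y) σ (ρ ! u) ≡ x
      go zero    reach = from-stays reach
      go (suc f) reach = [ from-stays , from-drops {f} ]′ (to (∨₂-sat (stays x r y u) (drops x f r y u)) reach)

    -- Ranks drop at most r times, so r + 1 alternatives suffice.
    reaches-complete : ∀ x f r (y u : Fin v) {ρ} σ → toℕ r < f → ρ ! y ≤ ρ ! u → rank W (ρ ! y) σ ≡ r →
                       track W (ρ ! y) σ (ρ ! u) ≡ x → ⟦ reaches x f r y u ⟧ ρ
    reaches-complete x (suc f) r y u {ρ} σ r<1+f y≤u rank₀ reached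
      with keeps-or-drops W (ρ ! y) σ (ρ ! u) y≤u rank₀
    ... | inj₁ keeps = from (∨₂-sat (stays x r y u) (drops x f r y u)) (inj₁ (from (stays-sat x r y u)
      (steady-while-keeping W (ρ ! y) σ keeps , subst (λ s → rank W (ρ ! u) s ≡ r) reached (keeps (ρ ! u) y≤u ≤-refl))))
    ... | inj₂ (t₁ , y<t₁ , t₁≤u , dropped , keeps)
      with fromℕ< (≤-<-trans t₁≤u (toℕ<n (ρ u))) | toℕ-fromℕ< (≤-<-trans t₁≤u (toℕ<n (ρ u)))
    ... | y′ | refl = from (∨₂-sat (stays x r y u) (drops x f r y u)) (inj₂ (from (drops-sat x f r y u)
      (rank W (toℕ y′) (track W (ρ ! y) σ (toℕ y′)) , dropped , y′ , y<t₁ , t₁≤u ,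
       steady-while-keeping W (ρ ! y) σ keeps , step-at-drop W (ρ ! y) σ y<t₁ keeps ,
       reaches-complete x f _ zero (suc u) _ (<-≤-trans dropped (≤-pred r<1+f)) t₁≤u refl
         (trans (track-restart W (ρ ! y) σ (<⇒≤ y<t₁) t₁≤u) reached))))

    private
      RunBetween : Elt → Fin v → Fin v → Env v → Set
      RunBetween x j k ρ = Σ (Fin n) λ u → suc (toℕ u) ≡ ρ ! k × ρ ! j < toℕ u ×
        Σ Elt λ r → rank W (ρ ! j) e ≡ r × ⟦ reaches x size r (suc j) zero ⟧ (extend u ρ)

      runBetween-sat : ∀ x (j k : Fin v) {ρ} → ⟦ runBetween x j k ⟧ ρ ⇔ RunBetween x j k ρ
      runBetween-sat x j k {ρ} = ∃-cong λ u → let ρ′ = extend u ρ in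
        ⇔-trans (∧₂-sat _ _) (successor-sat zero (suc k) ρ′ ×-⇔ ⇔-trans (∧₂-sat _ _) (<′-sat (suc j) zero ρ′ ×-⇔
          ⇔-trans (⋁-sat size _) (∃-cong λ r → ⇔-trans (∧₂-sat _ _) (hasRank-sat e r (suc j) ρ′ ×-⇔ ⇔-id _))))

    valueBetween-sat : ∀ x (j k : Fin v) {ρ} → ⟦ valueBetween x j k ⟧ ρ ⇔ between W (ρ ! j) (ρ ! k) ≡ x
    valueBetween-sat x j k {ρ} = ⇔-trans (∨₂-sat _ _) (mk⇔ ⇒value value⇒)
      where
      ⇒value : ⟦ fromDec (x Fin.≟ e) ∧₂ adjacent j k ⟧ ρ ⊎ ⟦ runBetween x j k ⟧ ρ → between W (ρ ! j) (ρ ! k) ≡ x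
      ⇒value (inj₁ empty) =
        let x≡e , adj = to (∧₂-sat (fromDec (x Fin.≟ e)) (adjacent j k)) empty
        in trans (between-empty W (to (adjacent-sat j k ρ) adj)) (sym (to (fromDec-sat (x Fin.≟ e)) x≡e))
      ⇒value (inj₂ via) =
        let u , 1+u≡k , j<u , r , rank-e , reach = to (runBetween-sat x j k) via
        in begin
          between W (ρ ! j) (ρ ! k)  ≡⟨ cong (between W (ρ ! j)) 1+u≡k ⟨
          segment W (ρ ! j) (toℕ u)  ≡⟨ identityˡ _ ⟨
          track W (ρ ! j) e (toℕ u)  ≡⟨ reaches-sound x size r (suc j) zero reach e (<⇒≤ j<u) rank-e ⟩
          x                          ∎
        where open ≡-Reasoning
      value⇒ : between W (ρ ! j) (ρ ! k) ≡ x → ⟦ fromDec (x Fin.≟ e) ∧₂ adjacent j k ⟧ ρ ⊎ ⟦ runBetween x j k ⟧ ρ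
      value⇒ value with suc (ρ ! j) ℕ.<? ρ ! k
      ... | no 1+j≮k = inj₁ (from (∧₂-sat (fromDec (x Fin.≟ e)) (adjacent j k))
        (from (fromDec-sat (x Fin.≟ e)) (trans (sym value) (between-empty W (≮⇒≥ 1+j≮k))) , from (adjacent-sat j k ρ) (≮⇒≥ 1+j≮k)))
      ... | yes 1+j<k with predecessor (ρ k) (λ k≡0 → contradiction (subst (suc (ρ ! j) <_) k≡0 1+j<k) λ ())
      ...   | u , 1+u≡k = inj₂ (from (runBetween-sat x j k) (u , 1+u≡k , j<u , rank W (ρ ! j) e , refl ,
              reaches-complete x size _ (suc j) zero e (toℕ<n _) (<⇒≤ j<u) refl
                (trans (identityˡ _) (trans (cong (between W (ρ ! j)) 1+u≡k) value))))
        where j<u = ≤-pred (subst (suc (ρ ! j) <_) (sym 1+u≡k) 1+j<k)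

    withRanksOf-sat : ∀ {l} (x : Fin v) (ss : Vec Elt l) G {ρ} →
                      ⟦ withRanksOf x ss G ⟧ ρ ⇔ ⟦ G (Vec.map (rank W (ρ ! x)) ss) ⟧ ρ
    withRanksOf-sat x []       G = ⇔-id _
    withRanksOf-sat x (s ∷ ss) G {ρ} = ⇔-trans (⋁-sat size _) (mk⇔ ⇒G G⇒)
      where
      ⇒G : Σ Elt (λ r → ⟦ hasRank s r x ∧₂ withRanksOf x ss (G ∘ (r ∷_)) ⟧ ρ) → ⟦ G (Vec.map (rank W (ρ ! x)) (s ∷ ss)) ⟧ ρ
      ⇒G (r , h) =
        let has-rank , rest = to (∧₂-sat (hasRank s r x) _) h
        in subst (λ r′ → ⟦ G (r′ ∷ _) ⟧ ρ) (sym (to (hasRank-sat s r x ρ) has-rank)) (to (withRanksOf-sat x ss _ {ρ}) rest)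
      G⇒ : ⟦ G (Vec.map (rank W (ρ ! x)) (s ∷ ss)) ⟧ ρ → Σ Elt (λ r → ⟦ hasRank s r x ∧₂ withRanksOf x ss (G ∘ (r ∷_)) ⟧ ρ)
      G⇒ h = rank W (ρ ! x) s , from (∧₂-sat (hasRank s _ x) _) (from (hasRank-sat s _ x ρ) refl , from (withRanksOf-sat x ss _ {ρ}) h)

    rankTable : ℕ → Vec Elt size
    rankTable z = Vec.map (rank W z) (Vec.allFin size)

    lookup-rankTable : ∀ z → Vec.lookup (rankTable z) ≗ rank W z
    lookup-rankTable z q = trans (Vecₚ.lookup-map q (rank W z) (Vec.allFin size)) (cong (rank W z) (Vecₚ.lookup-allFin q))

    withRanksAt-sat : ∀ (x : Fin v) G {ρ} → ⟦ withRanksAt x G ⟧ ρ ⇔ ⟦ G (rankTable (ρ ! x)) ⟧ ρ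
    withRanksAt-sat x G = withRanksOf-sat x (Vec.allFin size) G

    withSegment-sat : ∀ (a p : Fin v) G {ρ} → (ρ ! p < ρ ! a → w (ρ a) ≡ W (ρ ! a)) → ρ ! p ≤ ρ ! a →
                      ⟦ withSegment a p G ⟧ ρ ⇔ ⟦ G (segment W (ρ ! p) (ρ ! a)) ⟧ ρ
    withSegment-sat a p G {ρ} old-letter p≤a = ⇔-trans (∨₂-sat _ _) (mk⇔ ⇒G G⇒)
      where
      Inner = ⋁ size λ m′ → valueBetween m′ p a ∧₂ ⋁ size λ l → letterAt l a ∧₂ G (m′ ∙ l)
      ⇒G : ⟦ a ≐ p ∧₂ G e ⟧ ρ ⊎ ⟦ p <′ a ∧₂ Inner ⟧ ρ → ⟦ G (segment W (ρ ! p) (ρ ! a)) ⟧ ρ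
      ⇒G (inj₁ h) =
        let a≡p , Ge = to (∧₂-sat (a ≐ p) (G e)) h
        in subst (λ m → ⟦ G m ⟧ ρ) (sym (segment-≤ W (≤-reflexive (cong toℕ a≡p)))) Ge
      ⇒G (inj₂ h) =
        let p<a , h′        = to (∧₂-sat (p <′ a) Inner) h
            m′ , h″         = to (⋁-sat size _) h′
            value , h‴      = to (∧₂-sat (valueBetween m′ p a) _) h″
            l , h⁗          = to (⋁-sat size _) h‴
            letter-l , Gm   = to (∧₂-sat (letterAt l a) (G (m′ ∙ l))) h⁗
            m≡m′∙l = begin
              segment W (ρ ! p) (ρ ! a)             ≡⟨ segment-between W (to (<′-sat p a ρ) p<a) ⟩
              between W (ρ ! p) (ρ ! a) ∙ W (ρ ! a) ≡⟨ cong₂ _∙_ (to (valueBetween-sat m′ p a) value)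
                                                                (trans (sym (old-letter (to (<′-sat p a ρ) p<a))) letter-l) ⟩
              m′ ∙ l                                ∎
        in subst (λ m → ⟦ G m ⟧ ρ) (sym m≡m′∙l) Gm
        where open ≡-Reasoning
      G⇒ : ⟦ G (segment W (ρ ! p) (ρ ! a)) ⟧ ρ → ⟦ a ≐ p ∧₂ G e ⟧ ρ ⊎ ⟦ p <′ a ∧₂ Inner ⟧ ρ
      G⇒ Gm with m≤n⇒m<n∨m≡n p≤a
      ... | inj₂ p≡a = inj₁ (from (∧₂-sat (a ≐ p) (G e)) (toℕ-injective (sym p≡a) ,
              subst (λ m → ⟦ G m ⟧ ρ) (segment-≤ W (≤-reflexive (sym p≡a))) Gm))
      ... | inj₁ p<a = inj₂ (from (∧₂-sat (p <′ a) Inner) (from (<′-sat p a ρ) p<a ,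
              from (⋁-sat size _) (between W (ρ ! p) (ρ ! a) , from (∧₂-sat (valueBetween _ p a) _)
                (from (valueBetween-sat _ p a) refl , from (⋁-sat size _) (w (ρ a) , from (∧₂-sat (letterAt _ a) _)
                  (refl , subst (λ m → ⟦ G m ⟧ ρ) (trans (segment-between W p<a) (cong (_ ∙_) (sym (old-letter p<a)))) Gm))))))

    private
      old-letter : ∀ {c p₀} → SetAt w W p₀ c → ∀ (x : Fin n) → p₀ < toℕ x → w x ≡ W (toℕ x)
      old-letter {c} set-at x p<x = trans (set-at x) (setSeq-other W c λ x≡p → <-irrefl (sym x≡p) p<x)

      rank-after-set′ : ∀ c s {y₀ p₀ a₀} → suc y₀ ≡ p₀ → p₀ ≤ a₀ →
        toℕ (rank (setSeq W p₀ c) a₀ s) ≡ rankAfterSet (Vec.lookup (rankTable y₀)) (Vec.lookup (rankTable a₀)) (segment W p₀ a₀) c s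
      rank-after-set′ c s {y₀} {a₀ = a₀} refl y<a =
        AfterSetAt.rank-after-set W y₀ c a₀ y<a _ _ (lookup-rankTable y₀) (lookup-rankTable a₀) s

    recomputedRank-sat : ∀ c s r (y a p : Fin v) {ρ} → SetAt w W (ρ ! p) c → suc (ρ ! y) ≡ ρ ! p → ρ ! p ≤ ρ ! a →
                         ⟦ recomputedRank c s r y a p ⟧ ρ ⇔ rank (setSeq W (ρ ! p) c) (ρ ! a) s ≡ r
    recomputedRank-sat {v} c s r y a p {ρ} set-at 1+y≡p p≤a =
      ⇔-trans (withRanksAt-sat y G₁) (⇔-trans (withSegment-sat a p (G₂ ranks₁) (old-letter set-at (ρ a)) p≤a)
        (⇔-trans (withRanksAt-sat a (G₃ ranks₁ m)) (⇔-trans (fromDec-sat (rankAfterSet (Vec.lookup ranks₁) (Vec.lookup ranks₂) m c s ℕ.≟ toℕ r))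
          (mk⇔ (λ same → toℕ-injective (trans (rank-after-set′ c s 1+y≡p p≤a) same))
               (λ same → trans (sym (rank-after-set′ c s 1+y≡p p≤a)) (cong toℕ same))))))
      where
      ranks₁ = rankTable (ρ ! y)
      ranks₂ = rankTable (ρ ! a)
      m = segment W (ρ ! p) (ρ ! a)
      G₃ : Vec Elt size → Elt → Vec Elt size → Σ₂ v
      G₃ ρ₁ m ρ₂ = fromDec (rankAfterSet (Vec.lookup ρ₁) (Vec.lookup ρ₂) m c s ℕ.≟ toℕ r)
      G₂ : Vec Elt size → Elt → Σ₂ v
      G₂ ρ₁ m = withRanksAt a (G₃ ρ₁ m)
      G₁ : Vec Elt size → Σ₂ v
      G₁ ρ₁ = withSegment a p (G₂ ρ₁)

    rankAfter-sat : ∀ c s r (a p : Fin v) {ρ} → SetAt w W (ρ ! p) c →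
                    ⟦ rankAfter c s r a p ⟧ ρ ⇔ rank (setSeq W (ρ ! p) c) (ρ ! a) s ≡ r
    rankAfter-sat c s r a p {ρ} set-at = ⇔-trans (∨₂-sat _ _) (⇔-trans (⇔-id _ ⊎-⇔ ∨₂-sat _ _) (mk⇔ ⇒rank rank⇒))
      where
      Recomputed = ∃₂ (successor zero (suc p) ∧₂ suc p ≤′ suc a ∧₂ recomputedRank c s r zero (suc a) (suc p))
      new-rank≡old : ρ ! p ≡ 0 ⊎ ρ ! a < ρ ! p → rank (setSeq W (ρ ! p) c) (ρ ! a) s ≡ rank W (ρ ! a) s
      new-rank≡old p≡0⊎a<p = rank-unaffected W (ρ ! p) c (ρ ! a) p≡0⊎a<p s
      ⇒rank : ⟦ first p ∧₂ hasRank s r a ⟧ ρ ⊎ ⟦ a <′ p ∧₂ hasRank s r a ⟧ ρ ⊎ ⟦ Recomputed ⟧ ρ →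
              rank (setSeq W (ρ ! p) c) (ρ ! a) s ≡ r
      ⇒rank (inj₁ h) =
        let p-first , has-rank = to (∧₂-sat (first p) (hasRank s r a)) h
        in trans (new-rank≡old (inj₁ (to (first-sat p ρ) p-first))) (to (hasRank-sat s r a ρ) has-rank)
      ⇒rank (inj₂ (inj₁ h)) =
        let a<p , has-rank = to (∧₂-sat (a <′ p) (hasRank s r a)) h
        in trans (new-rank≡old (inj₂ (to (<′-sat a p ρ) a<p))) (to (hasRank-sat s r a ρ) has-rank)
      ⇒rank (inj₂ (inj₂ (y , h))) =
        let ρ′ = extend y ρ
            succ , h′ = to (∧₂-sat (successor zero (suc p)) (suc p ≤′ suc a ∧₂ recomputedRank c s r zero (suc a) (suc p)) {ρ′}) h
            p≤a , recomputed = to (∧₂-sat (suc p ≤′ suc a) (recomputedRank c s r zero (suc a) (suc p)) {ρ′}) h′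
        in to (recomputedRank-sat c s r zero (suc a) (suc p) {ρ′} set-at (to (successor-sat zero (suc p) ρ′) succ) p≤a) recomputed
      rank⇒ : rank (setSeq W (ρ ! p) c) (ρ ! a) s ≡ r →
              ⟦ first p ∧₂ hasRank s r a ⟧ ρ ⊎ ⟦ a <′ p ∧₂ hasRank s r a ⟧ ρ ⊎ ⟦ Recomputed ⟧ ρ
      rank⇒ new-rank = by-cases (ρ ! p ℕ.≟ 0) (ρ ! a ℕ.<? ρ ! p)
        where
        by-cases : Dec (ρ ! p ≡ 0) → Dec (ρ ! a < ρ ! p) →
                   ⟦ first p ∧₂ hasRank s r a ⟧ ρ ⊎ ⟦ a <′ p ∧₂ hasRank s r a ⟧ ρ ⊎ ⟦ Recomputed ⟧ ρ
        by-cases (yes p≡0) _ = inj₁ (from (∧₂-sat (first p) (hasRank s r a))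
          (from (first-sat p ρ) p≡0 , from (hasRank-sat s r a ρ) (trans (sym (new-rank≡old (inj₁ p≡0))) new-rank)))
        by-cases (no _) (yes a<p) = inj₂ (inj₁ (from (∧₂-sat (a <′ p) (hasRank s r a))
          (from (<′-sat a p ρ) a<p , from (hasRank-sat s r a ρ) (trans (sym (new-rank≡old (inj₂ a<p))) new-rank))))
        by-cases (no p≢0) (no a≮p) =
          let y , 1+y≡p = predecessor (ρ p) p≢0
              ρ′ = extend y ρ
          in inj₂ (inj₂ (y , from (∧₂-sat (successor zero (suc p)) (suc p ≤′ suc a ∧₂ recomputedRank c s r zero (suc a) (suc p)) {ρ′})
               (from (successor-sat zero (suc p) ρ′) 1+y≡p ,
                from (∧₂-sat (suc p ≤′ suc a) (recomputedRank c s r zero (suc a) (suc p)) {ρ′})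
                  (≮⇒≥ a≮p , from (recomputedRank-sat c s r zero (suc a) (suc p) {ρ′} set-at 1+y≡p (≮⇒≥ a≮p)) new-rank))))

    stepAfter-sat : ∀ c r r′ (a p : Fin v) {ρ} → SetAt w W (ρ ! p) c →
                    ⟦ stepAfter c r r′ a p ⟧ ρ ⇔ Step (setSeq W (ρ ! p) c) (ρ ! a) r r′
    stepAfter-sat c r r′ a p {ρ} set-at = mk⇔ ⇒step step⇒
      where
      W′ = setSeq W (ρ ! p) c
      Next : Elt → Σ₂ _
      Next s = ⋁ size λ l → letterAt l (suc a) ∧₂ rankAfter c (s ∙ l) r′ (suc a) (suc p)
      ⇒step : ⟦ stepAfter c r r′ a p ⟧ ρ → Step W′ (ρ ! a) r r′
      ⇒step (y , h) =
        let ρ′                = extend y ρ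
            succ , h′         = to (∧₂-sat (successor zero (suc a)) (⋁ size λ s → rankAfter c s r zero (suc p) ∧₂ Next s) {ρ′}) h
            s , h″            = to (⋁-sat size (λ s → rankAfter c s r zero (suc p) ∧₂ Next s) {ρ′}) h′
            rank-y , h‴       = to (∧₂-sat (rankAfter c s r zero (suc p)) (Next s) {ρ′}) h″
            l , h⁗            = to (⋁-sat size (λ l → letterAt l (suc a) ∧₂ rankAfter c (s ∙ l) r′ (suc a) (suc p)) {ρ′}) h‴
            letter-l , rank-a = to (∧₂-sat (letterAt l (suc a)) (rankAfter c (s ∙ l) r′ (suc a) (suc p)) {ρ′}) h⁗
            1+y≡a             = to (successor-sat zero (suc a) ρ′) succ
        in subst (λ z → Step W′ z r r′) 1+y≡a
             (s , to (rankAfter-sat c s r zero (suc p) {ρ′} set-at) rank-y ,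
              subst (λ z → rank W′ z (s ∙ W′ z) ≡ r′) (sym 1+y≡a)
                (subst (λ l′ → rank W′ (ρ ! a) (s ∙ l′) ≡ r′) (trans (sym letter-l) (set-at (ρ a)))
                  (to (rankAfter-sat c (s ∙ l) r′ (suc a) (suc p) {ρ′} set-at) rank-a)))
      step⇒ : Step W′ (ρ ! a) r r′ → ⟦ stepAfter c r r′ a p ⟧ ρ
      step⇒ step =
        let y , 1+y≡a       = predecessor (ρ a) (λ a≡0 → subst (λ z → Step W′ z r r′) a≡0 step)
            ρ′              = extend y ρ
            s , rank-y , rank-a = subst (λ z → Step W′ z r r′) (sym 1+y≡a) step
            rank-a′         = subst (λ l → rank W′ (ρ ! a) (s ∙ l) ≡ r′) (sym (set-at (ρ a)))
                                (subst (λ z → rank W′ z (s ∙ W′ z) ≡ r′) 1+y≡a rank-a)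
        in y , from (∧₂-sat (successor zero (suc a)) (⋁ size λ s → rankAfter c s r zero (suc p) ∧₂ Next s) {ρ′})
          (from (successor-sat zero (suc a) ρ′) 1+y≡a ,
           from (⋁-sat size (λ s → rankAfter c s r zero (suc p) ∧₂ Next s) {ρ′}) (s ,
             from (∧₂-sat (rankAfter c s r zero (suc p)) (Next s) {ρ′}) (from (rankAfter-sat c s r zero (suc p) {ρ′} set-at) rank-y ,
               from (⋁-sat size (λ l → letterAt l (suc a) ∧₂ rankAfter c (s ∙ l) r′ (suc a) (suc p)) {ρ′}) (w (ρ a) ,
                 from (∧₂-sat (letterAt (w (ρ a)) (suc a)) (rankAfter c (s ∙ w (ρ a)) r′ (suc a) (suc p)) {ρ′})
                   (refl , from (rankAfter-sat c (s ∙ w (ρ a)) r′ (suc a) (suc p) {ρ′} set-at) rank-a′)))))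

    update-sat : ∀ c x (a p : Fin n) → SetAt w W (toℕ p) c →
                 ⟦ updateFormula c x ⟧ (pair a p) ⇔ Holds (setSeq W (toℕ p) c) x (toℕ a)
    update-sat c (rankIs s r)  a p set-at = rankAfter-sat c s r zero (suc zero) set-at
    update-sat c (stepIs r r′) a p set-at = stepAfter-sat c r r′ zero (suc zero) set-at

module Correctness (M : FinMonoid) where
  open FinMonoid M
  open Segments M
  open Ranks M
  open Runs M
  open Words M
  open Program M
  open Prenex {size} {#symbols}

  Holds-cong : ∀ {W W′} → (∀ t → W t ≡ W′ t) → ∀ x z → Holds W x z ⇔ Holds W′ x z
  Holds-cong W≗W′ (rankIs s r) z = mk⇔ (trans (sym same-rank)) (trans same-rank)
    where same-rank = rank-agree z (λ i _ _ → W≗W′ i) s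
  Holds-cong W≗W′ (stepIs r r′) zero = mk⇔ (λ ()) (λ ())
  Holds-cong {W} {W′} W≗W′ (stepIs r r′) (suc y) = mk⇔
    (λ (s , rank-y , rank-z) → s , trans (sym (same-rank y s)) rank-y ,
       trans (sym (same-rank (suc y) _)) (subst (λ l → rank W (suc y) (s ∙ l) ≡ r′) (W≗W′ (suc y)) rank-z))
    (λ (s , rank-y , rank-z) → s , trans (same-rank y s) rank-y ,
       trans (same-rank (suc y) _) (subst (λ l → rank W′ (suc y) (s ∙ l) ≡ r′) (sym (W≗W′ (suc y))) rank-z))
    where
    same-rank : ∀ z s → rank W z s ≡ rank W′ z s
    same-rank z = rank-agree z λ i _ _ → W≗W′ i

  Invariant : ∀ {n} → State M #symbols n → Set
  Invariant s = Represents (toSeq (State.word s)) (State.auxs s)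

  invariant-init : ∀ n → Invariant (initState M program n)
  invariant-init n i a = ⇔-trans (init-sat (decode i) a) (Holds-cong (λ t → sym (toSeq-initWord n t)) (decode i) (toℕ a))

  invariant-step : ∀ {n} (s : State M #symbols n) ch → Invariant s → Invariant (step M program s ch)
  invariant-step (st w A) (c , p) represents i a =
    ⇔-trans (Meaning.update-sat w′ A (toSeq w) represents a c (decode i) a p set-at)
            (Holds-cong (λ t → sym (toSeq-setWord w c p t)) (decode i) (toℕ a))
    where
    w′ = setWord M w c p
    set-at : SetAt w′ (toSeq w) (toℕ p) c
    set-at x = trans (sym (toSeq-toℕ w′ x)) (toSeq-setWord w c p (toℕ x))

  invariant-run : ∀ {n} (cs : List (Change M n)) s → Invariant s → Invariant (run M program s cs)
  invariant-run []        s inv = inv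
  invariant-run (ch ∷ cs) s inv = invariant-run cs (step M program s ch) (invariant-step s ch inv)

  query : Elt → Σ₂ 2
  query x = valueBetween x zero (suc zero)

  query-sat : ∀ {n} (s : State M #symbols n) → Invariant s → ∀ x (j k : Fin n) →
              Sat (State.word s) (State.auxs s) ⌜ query x ⌝ (pair j k) ⇔ (infixValue M (State.word s) j k ≡ x)
  query-sat (st w A) represents x j k =
    ⇔-trans (Meaning.valueBetween-sat w A (toSeq w) represents j x zero (suc zero))
            (mk⇔ (trans (infixValue≡between w j k)) (trans (sym (infixValue≡between w j k))))

mainTheorem6 : (M : FinMonoid) →
    Σ ℕ λ k → Σ (DynProg (FinMonoid.size M) k) λ Π →
      ((r : Fin k) (c : Fin (FinMonoid.size M)) → IsΣ2 (DynProg.update Π r c))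
      × ((x : Fin (FinMonoid.size M)) →
          Σ (FO (FinMonoid.size M) k 2) λ ψ →
            IsΣ2 ψ
            × ((n : ℕ) (cs : List (Change M n)) (j k' : Fin n) →
                (Sat (State.word (run M Π (initState M Π n) cs))
                     (State.auxs (run M Π (initState M Π n) cs))
                     ψ (pair j k')
                  ⇔ (infixValue M (State.word (run M Π (initState M Π n) cs)) j k' ≡ x))))
mainTheorem6 M = #symbols , program , (λ i c → ⌜⌝-isΣ2 (updateFormula c (decode i))) , λ x →
  ⌜ query x ⌝ , ⌜⌝-isΣ2 (query x) , λ n cs j k →
    query-sat (run M program (initState M program n) cs) (invariant-run cs _ (invariant-init n)) x j k
  where
  open Program M
  open Prenex
  open Correctness M
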